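{- Let $\mathbb{C}$ be a ribbon category, $A$ a reflexive object with isomorphism $\varphi:A\otimes A^*\to A$, and $\mathcal{A}=\mathbb{C}(I,A)$ with the structure described below. Let $\mathbf{Tr}:=F(\mathbf{lam})$, an element of $\mathcal{I}_{\mathcal{A}}(1,2)$. Then for every $a\in\mathcal{I}_{\mathcal{A}}(1+m,1+n)$, $\mathbf{Tr}\,a$ equals the left trace of $a$ in the ribbon category $\mathcal{I}_{\mathcal{A}}$, namely $\mathbf{Tr}\,a=\boldsymbol{\alpha}\circ((\mathbf{B}\,a)\circ\boldsymbol{\beta})\in\mathcal{I}_{\mathcal{A}}(m,n)$, where $\boldsymbol{\alpha}:=F(\alpha)$, $\boldsymbol{\beta}:=F(\beta)$, $\alpha:=\mathrm{Tr}^A_{I,A\otimes A}(\mathbf{lam};(A\otimes\mathbf{lam}))$, $\beta:=\mathrm{Tr}^A_{A\otimes A,I}((A\otimes\mathbf{app});\mathbf{app})$.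
   Context: Ribbon category: a (strict) braided monoidal category with braid $\sigma_{X,Y}:X\otimes Y\to Y\otimes X$, natural twist isomorphism $\theta$ with $\theta_{X\otimes Y}=\sigma_{X,Y};(\theta_Y\otimes\theta_X);\sigma_{Y,X}$, every object $X$ having a left dual $X^*$ with unit $\eta_X:I\to X\otimes X^*$, counit $\varepsilon_X:X^*\otimes X\to I$ satisfying the snake equations, and $(\theta_X)^*=\theta_{X^*}$; composition $f;g$ is diagrammatic. Trace: $\mathrm{Tr}^X_{U,V}(f)=(U\otimes\eta_X);(f\otimes X^*);(V\otimes(\sigma_{X,X^*};(X^*\otimes\theta_X);\varepsilon_X))$. A reflexive object is an object $A$ with an isomorphism $\varphi:A\otimes A^*\to A$. $\mathbf{app}:=(\varphi^{ -1}\otimes A);(A\otimes\varepsilon_A)$; $\mathbf{lam}:=(A\otimes\eta_A);(A\otimes A\otimes\theta_{A^*}^{ -1});(A\otimes\sigma^{ -1}_{A^*,A});(\varphi\otimes A)$; $\mathbf{app}_0=\mathrm{id}_A$, $\mathbf{app}_{n+1}=(\mathbf{app}\otimes A^{\otimes n});\mathbf{app}_n$; $\mathbf{lam}_0=\mathrm{id}_A$, $\mathbf{lam}_{m+1}=\mathbf{lam}_m;(\mathbf{lam}\otimes A^{\otimes m})$; for $f:A^{\otimes m}\to A^{\otimes n}$, $F(f):=\mathrm{Tr}^A_{I,A}(\mathbf{lam}_m;(\mathbf{lam}\otimes f);(A\otimes\mathbf{app}_n)):I\to A$. $\mathcal{A}=\mathbb{C}(I,A)$ has application $a\,b=(a\otimes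 b);\mathbf{app}$ (left-associative) and elements $\mathbf{B}=F(\mathbf{app})$, $\mathbf{C}^\pm=F(\sigma_{A,A}^{\pm1})$, $\mathbf{I}=F(\mathrm{id}_I)$, $\boldsymbol{\theta}^\pm=F(\theta_A^{\pm1})$. Write $a\circ b:=\mathbf{B}\,a\,b$, $a^0=\mathbf{I}$, $a^{n+1}=a\circ a^n$, $a^\bullet:=\mathbf{C}^+\,\mathbf{I}\,a$; $a$ has arity $m\to n$ if $a^\bullet\circ\mathbf{B}^{m+1}=(\mathbf{B}\,a)\circ\mathbf{B}^n$. The internal PROB $\mathcal{I}_{\mathcal{A}}$ has objects natural numbers, morphisms $m\to n$ the elements of arity $m\to n$, composite of $a:l\to m$, $b:m\to n$ equal to $a\circ b$, identities $\mathbf{I}$, tensor $m+n$ on objects and $a+b:=a\circ(\mathbf{B}^n\,b)$ on morphisms $a:m\to n$, $b:m'\to n'$; its braid is $\boldsymbol{\sigma}_{0,1}=\mathbf{I}$, $\boldsymbol{\sigma}_{m+1,1}=(\mathbf{B}\,\boldsymbol{\sigma}_{m,1})\circ\mathbf{C}^+$, $\boldsymbol{\sigma}_{m,0}=\mathbf{I}$, $\boldsymbol{\sigma}_{m,n+1}=\boldsymbol{\sigma}_{m,1}\circ(\mathbf{B}\,\boldsymbol{\sigma}_{m,n})$, twist $\boldsymbol{\theta}_0=\mathbf{I}$, $\boldsymbol{\theta}_1=\boldsymbol{\theta}^+$, $\boldsymbol{\theta}_{m+1}=\boldsymbol{\theta}^+\circ(\boldsymbol{\sigma}_{1,m}\circ(\boldsymbol{\theta}_m\circ\boldsymbol{\sigma}_{m,1}))$,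 and object $1$ is self-dual with unit $\boldsymbol{\alpha}$ and counit $\boldsymbol{\beta}$. -}

module Defs where

-- Composition f ⨾ g is diagrammatic (f first).
--
-- Strictness: the monoidal structure is strict, i.e. (X⊗Y)⊗Z, I⊗X, X⊗I are
-- *equal* to X⊗(Y⊗Z), X, X as objects (propositional equality ≡ on objects;
-- this development uses K, so these identifications are coherent), and the
-- tensor of morphisms commutes with the induced transports `coe`.  Wherever
-- the paper silently uses such an identification we insert `coe`.

open import Level using (Level; _⊔_) renaming (suc to lsuc)
open import Data.Nat using (ℕ; zero; suc)
open import Relation.Binary.Core using (Rel)
open import Relation.Binary.Structures using (IsEquivalence)
open import Relation.Binary.PropositionalEquality using (_≡_; refl; sym; cong)

record Category (o ℓ e : Level) : Set (lsuc (o ⊔ ℓ ⊔ e)) where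
  infix  4 _≈_
  infixl 9 _⨾_
  field
    Obj      : Set o
    Hom      : Obj → Obj → Set ℓ
    _≈_      : ∀ {X Y} → Rel (Hom X Y) e
    id       : ∀ {X} → Hom X X
    _⨾_      : ∀ {X Y Z} → Hom X Y → Hom Y Z → Hom X Z
    ≈-equiv  : ∀ {X Y} → IsEquivalence (_≈_ {X} {Y})
    ⨾-resp-≈ : ∀ {X Y Z} {f f' : Hom X Y} {g g' : Hom Y Z} →
               f ≈ f' → g ≈ g' → f ⨾ g ≈ f' ⨾ g'
    identityˡ : ∀ {X Y} {f : Hom X Y} → id ⨾ f ≈ f
    identityʳ : ∀ {X Y} {f : Hom X Y} → f ⨾ id ≈ f
    ⨾-assoc   : ∀ {W X Y Z} {f : Hom W X} {g : Hom X Y} {h : Hom Y Z} →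
                (f ⨾ g) ⨾ h ≈ f ⨾ (g ⨾ h)

  coe : ∀ {X Y} → X ≡ Y → Hom X Y
  coe refl = id

record StrictMonoidal {o ℓ e} (C : Category o ℓ e) : Set (o ⊔ ℓ ⊔ e) where
  open Category C
  infixr 10 _⊗₀_ _⊗₁_
  field
    𝟙    : Obj
    _⊗₀_ : Obj → Obj → Obj
    _⊗₁_ : ∀ {X Y Z W} → Hom X Y → Hom Z W → Hom (X ⊗₀ Z) (Y ⊗₀ W)
    ⊗-resp-≈ : ∀ {X Y Z W} {f f' : Hom X Y} {g g' : Hom Z W} →
               f ≈ f' → g ≈ g' → f ⊗₁ g ≈ f' ⊗₁ g'
    ⊗-id : ∀ {X Y} → id {X} ⊗₁ id {Y} ≈ id
    ⊗-⨾  : ∀ {X₁ Y₁ Z₁ X₂ Y₂ Z₂}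
             {f : Hom X₁ Y₁} {g : Hom Y₁ Z₁} {h : Hom X₂ Y₂} {k : Hom Y₂ Z₂} →
           (f ⨾ g) ⊗₁ (h ⨾ k) ≈ (f ⊗₁ h) ⨾ (g ⊗₁ k)
    ⊗-assoc₀ : ∀ {X Y Z} → (X ⊗₀ Y) ⊗₀ Z ≡ X ⊗₀ (Y ⊗₀ Z)
    unitˡ₀   : ∀ {X} → 𝟙 ⊗₀ X ≡ X
    unitʳ₀   : ∀ {X} → X ⊗₀ 𝟙 ≡ X
    ⊗-assoc₁ : ∀ {X₁ Y₁ X₂ Y₂ X₃ Y₃}
                 {f : Hom X₁ Y₁} {g : Hom X₂ Y₂} {h : Hom X₃ Y₃} →
               ((f ⊗₁ g) ⊗₁ h) ⨾ coe ⊗-assoc₀ ≈ coe ⊗-assoc₀ ⨾ (f ⊗₁ (g ⊗₁ h))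
    unitˡ₁   : ∀ {X Y} {f : Hom X Y} →
               (id {𝟙} ⊗₁ f) ⨾ coe unitˡ₀ ≈ coe unitˡ₀ ⨾ f
    unitʳ₁   : ∀ {X Y} {f : Hom X Y} →
               (f ⊗₁ id {𝟙}) ⨾ coe unitʳ₀ ≈ coe unitʳ₀ ⨾ f

record Ribbon {o ℓ e} {C : Category o ℓ e} (M : StrictMonoidal C)
       : Set (o ⊔ ℓ ⊔ e) where
  open Category C
  open StrictMonoidal M
  infix 20 _*
  field
    σ   : ∀ X Y → Hom (X ⊗₀ Y) (Y ⊗₀ X)
    σ⁻¹ : ∀ X Y → Hom (Y ⊗₀ X) (X ⊗₀ Y)
    σ-σ⁻¹ : ∀ {X Y} → σ X Y ⨾ σ⁻¹ X Y ≈ id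
    σ⁻¹-σ : ∀ {X Y} → σ⁻¹ X Y ⨾ σ X Y ≈ id
    σ-natural : ∀ {X₁ Y₁ X₂ Y₂} {f : Hom X₁ Y₁} {g : Hom X₂ Y₂} →
                (f ⊗₁ g) ⨾ σ Y₁ Y₂ ≈ σ X₁ X₂ ⨾ (g ⊗₁ f)
    hexagon₁ : ∀ {X Y Z} →
      σ X (Y ⊗₀ Z) ≈
        coe (sym ⊗-assoc₀) ⨾ (σ X Y ⊗₁ id {Z}) ⨾ coe ⊗-assoc₀
        ⨾ (id {Y} ⊗₁ σ X Z) ⨾ coe (sym ⊗-assoc₀)
    hexagon₂ : ∀ {X Y Z} →
      σ (X ⊗₀ Y) Z ≈
        coe ⊗-assoc₀ ⨾ (id {X} ⊗₁ σ Y Z) ⨾ coe (sym ⊗-assoc₀)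
        ⨾ (σ X Z ⊗₁ id {Y}) ⨾ coe ⊗-assoc₀
    θ   : ∀ X → Hom X X
    θ⁻¹ : ∀ X → Hom X X
    θ-θ⁻¹ : ∀ {X} → θ X ⨾ θ⁻¹ X ≈ id
    θ⁻¹-θ : ∀ {X} → θ⁻¹ X ⨾ θ X ≈ id
    θ-natural : ∀ {X Y} {f : Hom X Y} → f ⨾ θ Y ≈ θ X ⨾ f
    θ-⊗ : ∀ {X Y} → θ (X ⊗₀ Y) ≈ σ X Y ⨾ (θ Y ⊗₁ θ X) ⨾ σ Y X
    _*  : Obj → Obj
    η   : ∀ X → Hom 𝟙 (X ⊗₀ X *)
    ε   : ∀ X → Hom (X * ⊗₀ X) 𝟙
    snake₁ : ∀ {X} →
      coe (sym unitˡ₀) ⨾ (η X ⊗₁ id {X}) ⨾ coe ⊗-assoc₀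
      ⨾ (id {X} ⊗₁ ε X) ⨾ coe unitʳ₀ ≈ id
    snake₂ : ∀ {X} →
      coe (sym unitʳ₀) ⨾ (id {X *} ⊗₁ η X) ⨾ coe (sym ⊗-assoc₀)
      ⨾ (ε X ⊗₁ id {X *}) ⨾ coe unitˡ₀ ≈ id
    -- ribbon condition (θ_X)* = θ_{X*}, where for f : X → Y,
    -- f* = (Y* ⊗ η_X) ; (Y* ⊗ f ⊗ X*) ; (ε_Y ⊗ X*)
    θ-dual : ∀ {X} →
      coe (sym unitʳ₀) ⨾ (id {X *} ⊗₁ η X) ⨾ (id {X *} ⊗₁ (θ X ⊗₁ id {X *}))
      ⨾ coe (sym ⊗-assoc₀) ⨾ (ε X ⊗₁ id {X *}) ⨾ coe unitˡ₀ ≈ θ (X *)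

record Reflexive {o ℓ e} {C : Category o ℓ e} {M : StrictMonoidal C}
       (R : Ribbon M) : Set (o ⊔ ℓ ⊔ e) where
  open Category C
  open StrictMonoidal M
  open Ribbon R
  field
    A    : Obj
    φ    : Hom (A ⊗₀ A *) A
    φ⁻¹  : Hom A (A ⊗₀ A *)
    φ-φ⁻¹ : φ ⨾ φ⁻¹ ≈ id
    φ⁻¹-φ : φ⁻¹ ⨾ φ ≈ id

module Combinators {o ℓ e} {C : Category o ℓ e} {M : StrictMonoidal C}
       {R : Ribbon M} (Rf : Reflexive R) where
  open Category C
  open StrictMonoidal M
  open Ribbon R
  open Reflexive Rf

  trace : ∀ X U V → Hom (U ⊗₀ X) (V ⊗₀ X) → Hom U V
  trace X U V f =
    coe (sym unitʳ₀) ⨾ (id {U} ⊗₁ η X) ⨾ coe (sym ⊗-assoc₀)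
    ⨾ (f ⊗₁ id {X *}) ⨾ coe ⊗-assoc₀
    ⨾ (id {V} ⊗₁ (σ X (X *) ⨾ (id {X *} ⊗₁ θ X) ⨾ ε X)) ⨾ coe unitʳ₀

  A^ : ℕ → Obj
  A^ zero    = 𝟙
  A^ (suc n) = A ⊗₀ A^ n

  app : Hom (A ⊗₀ A) A
  app = (φ⁻¹ ⊗₁ id {A}) ⨾ coe ⊗-assoc₀ ⨾ (id {A} ⊗₁ ε A) ⨾ coe unitʳ₀

  lam : Hom A (A ⊗₀ A)
  lam = coe (sym unitʳ₀) ⨾ (id {A} ⊗₁ η A)
        ⨾ (id {A} ⊗₁ (id {A} ⊗₁ θ⁻¹ (A *)))
        ⨾ (id {A} ⊗₁ σ⁻¹ (A *) A) ⨾ coe (sym ⊗-assoc₀) ⨾ (φ ⊗₁ id {A})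

  appₙ : ∀ n → Hom (A ⊗₀ A^ n) A
  appₙ zero    = coe unitʳ₀
  appₙ (suc n) = coe (sym ⊗-assoc₀) ⨾ (app ⊗₁ id {A^ n}) ⨾ appₙ n

  lamₘ : ∀ m → Hom A (A ⊗₀ A^ m)
  lamₘ zero    = coe (sym unitʳ₀)
  lamₘ (suc m) = lamₘ m ⨾ (lam ⊗₁ id {A^ m}) ⨾ coe ⊗-assoc₀

  F : ∀ {m n} → Hom (A^ m) (A^ n) → Hom 𝟙 A
  F {m} {n} f = trace A 𝟙 A
    (coe unitˡ₀ ⨾ lamₘ m ⨾ (lam ⊗₁ f) ⨾ coe ⊗-assoc₀ ⨾ (id {A} ⊗₁ appₙ n))

  p1 : A^ 1 ≡ A
  p1 = unitʳ₀
  p2 : A^ 2 ≡ A ⊗₀ A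
  p2 = cong (A ⊗₀_) unitʳ₀

  𝒜 : Set ℓ
  𝒜 = Hom 𝟙 A

  infixl 8 _·_
  _·_ : 𝒜 → 𝒜 → 𝒜
  a · b = coe (sym unitˡ₀) ⨾ (a ⊗₁ b) ⨾ app

  𝐁 : 𝒜
  𝐁 = F {2} {1} (coe p2 ⨾ app ⨾ coe (sym p1))

  𝐂⁺ : 𝒜
  𝐂⁺ = F {2} {2} (coe p2 ⨾ σ A A ⨾ coe (sym p2))

  𝐈 : 𝒜
  𝐈 = F {0} {0} (id {𝟙})

  α : Hom 𝟙 (A ⊗₀ A)
  α = trace A 𝟙 (A ⊗₀ A)
        (coe unitˡ₀ ⨾ lam ⨾ (id {A} ⊗₁ lam) ⨾ coe (sym ⊗-assoc₀))

  β : Hom (A ⊗₀ A) 𝟙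
  β = trace A (A ⊗₀ A) 𝟙
        (coe ⊗-assoc₀ ⨾ (id {A} ⊗₁ app) ⨾ app ⨾ coe (sym unitˡ₀))

  𝛂 : 𝒜
  𝛂 = F {0} {2} (α ⨾ coe (sym p2))

  𝛃 : 𝒜
  𝛃 = F {2} {0} (coe p2 ⨾ β)

  𝐓𝐫 : 𝒜
  𝐓𝐫 = F {1} {2} (coe p1 ⨾ lam ⨾ coe (sym p2))

  infixr 7 _∘_
  _∘_ : 𝒜 → 𝒜 → 𝒜
  a ∘ b = 𝐁 · a · b

  _^_ : 𝒜 → ℕ → 𝒜
  a ^ zero  = 𝐈
  a ^ suc n = a ∘ (a ^ n)

  _• : 𝒜 → 𝒜
  a • = 𝐂⁺ · 𝐈 · a

  -- a has arity m → n, i.e. a ∈ 𝓘_𝒜(m, n)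
  HasArity : ℕ → ℕ → 𝒜 → Set e
  HasArity m n a = ((a •) ∘ (𝐁 ^ suc m)) ≈ ((𝐁 · a) ∘ (𝐁 ^ n))

{-# OPTIONS --safe #-}

-- An element x : I → A is determined by its action x · (−) = (x ⊗ A) ; app, because φ is
-- invertible: x = η ; ((x · (−)) ⊗ A*) ; φ.  The constants act through the β-law of F,
-- (F f ⊗ A^{m+1}) ; app_{m+1} = (A ⊗ f) ; app_n: unfolding lam_{m+1} gives nested twisted cups
-- followed by iterated φ, which app_{m+1} turns back into nested caps, and the trace closes the
-- loop by the snake equations, its twist cancelling the one built into lam.
--
-- Applied to an argument, 𝐓𝐫 · a acts as lam ; a(−, −), and 𝛂 ∘ ((𝐁 · a) ∘ 𝛃) acts as
-- (𝛃 · −) ; (A ⊗ α) ; (app ⊗ A) ; a(−, −).  So it remains to see that (𝛃 · −) ; (A ⊗ α) ; (app ⊗ A)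
-- is lam.  In planar form α is a double cup followed by φ ⊗ φ and β is φ⁻¹ ⊗ φ⁻¹ followed by a
-- double cap, so the composite contains the cup α ; (A ⊗ η ⊗ A) ; (β ⊗ A* ⊗ A), which the snake
-- equations straighten into the twisted cup of lam.

module Submission where

open import Level using (_⊔_)
open import Data.Nat using (ℕ; zero; suc)
open import Data.List using (List; []; _∷_; _++_)
open import Relation.Binary.PropositionalEquality using (_≡_; refl; sym; trans; cong)
open import Relation.Binary.Structures using (IsEquivalence)

open import Defs

module RibbonCalculus {o ℓ e} {C : Category o ℓ e} {M : StrictMonoidal C} (R : Ribbon M) where
  open Category C
  open StrictMonoidal M
  open Ribbon R

  module ≈ {X Y : Obj} = IsEquivalence (≈-equiv {X} {Y})

  infix 4 _≋_
  data _≋_ {X Y X′ Y′ : Obj} (f : Hom X Y) (g : Hom X′ Y′) : Set (o ⊔ e) where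
    mk≋ : (p : X ≡ X′) (q : Y ≡ Y′) → f ⨾ coe q ≈ coe p ⨾ g → f ≋ g

  ≈⇒≋ : ∀ {X Y} {f g : Hom X Y} → f ≈ g → f ≋ g
  ≈⇒≋ e = mk≋ refl refl (≈.trans identityʳ (≈.trans e (≈.sym identityˡ)))

  ≋⇒≈ : ∀ {X Y} {f g : Hom X Y} → f ≋ g → f ≈ g
  ≋⇒≈ (mk≋ refl refl e) = ≈.trans (≈.sym identityʳ) (≈.trans e identityˡ)

  ≋-refl : ∀ {X Y} {f : Hom X Y} → f ≋ f
  ≋-refl = ≈⇒≋ ≈.refl

  ≋-sym : ∀ {X Y X′ Y′} {f : Hom X Y} {g : Hom X′ Y′} → f ≋ g → g ≋ f
  ≋-sym p@(mk≋ refl refl _) = ≈⇒≋ (≈.sym (≋⇒≈ p))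

  ≋-trans : ∀ {X Y X′ Y′ X′′ Y′′} {f : Hom X Y} {g : Hom X′ Y′} {h : Hom X′′ Y′′} →
            f ≋ g → g ≋ h → f ≋ h
  ≋-trans p@(mk≋ refl refl _) q@(mk≋ refl refl _) = ≈⇒≋ (≈.trans (≋⇒≈ p) (≋⇒≈ q))

  ⨾-resp-≋ : ∀ {X Y Z X′ Y′ Z′} {f : Hom X Y} {g : Hom Y Z} {f′ : Hom X′ Y′} {g′ : Hom Y′ Z′} →
             f ≋ f′ → g ≋ g′ → f ⨾ g ≋ f′ ⨾ g′
  ⨾-resp-≋ p@(mk≋ refl refl _) q@(mk≋ refl refl _) = ≈⇒≋ (⨾-resp-≈ (≋⇒≈ p) (≋⇒≈ q))

  ⊗-resp-≋ : ∀ {X Y Z W X′ Y′ Z′ W′} {f : Hom X Y} {g : Hom Z W} {f′ : Hom X′ Y′} {g′ : Hom Z′ W′} →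
             f ≋ f′ → g ≋ g′ → f ⊗₁ g ≋ f′ ⊗₁ g′
  ⊗-resp-≋ p@(mk≋ refl refl _) q@(mk≋ refl refl _) = ≈⇒≋ (⊗-resp-≈ (≋⇒≈ p) (≋⇒≈ q))

  ⊗-assoc≋ : ∀ {X₁ Y₁ X₂ Y₂ X₃ Y₃} {f : Hom X₁ Y₁} {g : Hom X₂ Y₂} {h : Hom X₃ Y₃} →
             (f ⊗₁ g) ⊗₁ h ≋ f ⊗₁ (g ⊗₁ h)
  ⊗-assoc≋ = mk≋ ⊗-assoc₀ ⊗-assoc₀ ⊗-assoc₁

  ⊗-unitˡ≋ : ∀ {X Y} {f : Hom X Y} → id {𝟙} ⊗₁ f ≋ f
  ⊗-unitˡ≋ = mk≋ unitˡ₀ unitˡ₀ unitˡ₁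

  ⊗-unitʳ≋ : ∀ {X Y} {f : Hom X Y} → f ⊗₁ id {𝟙} ≋ f
  ⊗-unitʳ≋ = mk≋ unitʳ₀ unitʳ₀ unitʳ₁

  id≋id : ∀ {X Y} → X ≡ Y → id {X} ≋ id {Y}
  id≋id refl = ≋-refl

  θ-cong≋ : ∀ {X Y} → X ≡ Y → θ X ≋ θ Y
  θ-cong≋ refl = ≋-refl

  σ-cong≋ : ∀ {X Y X′ Y′} → X ≡ X′ → Y ≡ Y′ → σ X Y ≋ σ X′ Y′
  σ-cong≋ refl refl = ≋-refl

  coe-elimˡ : ∀ {X X′ Y X′′ Y′′} (p : X ≡ X′) {f : Hom X′ Y} {g : Hom X′′ Y′′} →
              f ≋ g → coe p ⨾ f ≋ g
  coe-elimˡ refl q = ≋-trans (≈⇒≋ identityˡ) q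

  coe-elimʳ : ∀ {X Y Y′ X′′ Y′′} (p : Y ≡ Y′) {f : Hom X Y} {g : Hom X′′ Y′′} →
              f ≋ g → f ⨾ coe p ≋ g
  coe-elimʳ refl q = ≋-trans (≈⇒≋ identityʳ) q

  coe-elimᵐ : ∀ {X Y Y₂ Z X′ Y′ Z′} (p : Y ≡ Y₂) {f : Hom X Y} {g : Hom Y₂ Z}
                {f′ : Hom X′ Y′} {g′ : Hom Y′ Z′} →
              f ≋ f′ → g ≋ g′ → f ⨾ coe p ⨾ g ≋ f′ ⨾ g′
  coe-elimᵐ refl q r = ⨾-resp-≋ (coe-elimʳ refl q) r

  ⨾coe⨾-resp-≋ : ∀ {X Y Y₂ Z X′ Y′ Y₂′ Z′} (p : Y ≡ Y₂) (q : Y′ ≡ Y₂′)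
                   {f : Hom X Y} {g : Hom Y₂ Z} {f′ : Hom X′ Y′} {g′ : Hom Y₂′ Z′} →
                 f ≋ f′ → g ≋ g′ → f ⨾ coe p ⨾ g ≋ f′ ⨾ coe q ⨾ g′
  ⨾coe⨾-resp-≋ refl refl r@(mk≋ refl refl _) s = ⨾-resp-≋ (⨾-resp-≋ r ≋-refl) s

  ≋id-elimˡ : ∀ {X Y Z W} {f : Hom X Y} {g : Hom Y W} → f ≋ id {Z} → f ⨾ g ≋ g
  ≋id-elimˡ p@(mk≋ refl refl _) = ≋-trans (≈⇒≋ (⨾-resp-≈ (≋⇒≈ p) ≈.refl)) (≈⇒≋ identityˡ)

  ≋id-elimʳ : ∀ {X Y Z W} {f : Hom X Y} {g : Hom Y W} → g ≋ id {Z} → f ⨾ g ≋ f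
  ≋id-elimʳ p@(mk≋ refl refl _) = ≋-trans (≈⇒≋ (⨾-resp-≈ ≈.refl (≋⇒≈ p))) (≈⇒≋ identityʳ)

  id⊗coe≋id : ∀ {X Y Y′} (p : Y ≡ Y′) → id {X} ⊗₁ coe p ≋ id {X ⊗₀ Y}
  id⊗coe≋id refl = ≈⇒≋ ⊗-id

  ⟦_⟧ : List Obj → Obj
  ⟦ [] ⟧         = 𝟙
  ⟦ X ∷ [] ⟧     = X
  ⟦ X ∷ Y ∷ w ⟧ = X ⊗₀ ⟦ Y ∷ w ⟧

  ⟦++⟧ : ∀ w v → ⟦ w ++ v ⟧ ≡ ⟦ w ⟧ ⊗₀ ⟦ v ⟧
  ⟦++⟧ []            v       = sym unitˡ₀
  ⟦++⟧ (X ∷ [])      []      = sym unitʳ₀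
  ⟦++⟧ (X ∷ [])      (Y ∷ v) = refl
  ⟦++⟧ (X ∷ Y ∷ w)  v       = trans (cong (X ⊗₀_) (⟦++⟧ (Y ∷ w) v)) (sym ⊗-assoc₀)

  -- Tensoring words is list concatenation, so associativity and unit laws hold on the nose
  -- for concrete words.
  record Mor (w v : List Obj) : Set ℓ where
    constructor ⌜_⌝
    field un : Hom ⟦ w ⟧ ⟦ v ⟧
  open Mor public

  infix 4 _≈m_
  record _≈m_ {w v} (f g : Mor w v) : Set e where
    constructor mk
    field pf : un f ≈ un g
  open _≈m_ public

  ≋⇒≈m : ∀ {w v} {f g : Mor w v} → un f ≋ un g → f ≈m g
  ≋⇒≈m p = mk (≋⇒≈ p)

  ≈m-refl : ∀ {w v} {f : Mor w v} → f ≈m f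
  ≈m-refl = mk ≈.refl

  ≈m-sym : ∀ {w v} {f g : Mor w v} → f ≈m g → g ≈m f
  ≈m-sym (mk p) = mk (≈.sym p)

  infixr 1 _⟫_
  _⟫_ : ∀ {w v} {f g h : Mor w v} → f ≈m g → g ≈m h → f ≈m h
  mk p ⟫ mk q = mk (≈.trans p q)

  infix  1 begin_
  infixr 2 _≈⟨_⟩_
  infix  3 _∎

  begin_ : ∀ {w v} {f g : Mor w v} → f ≈m g → f ≈m g
  begin p = p

  _≈⟨_⟩_ : ∀ {w v} (f : Mor w v) {g h : Mor w v} → f ≈m g → g ≈m h → f ≈m h
  f ≈⟨ p ⟩ q = p ⟫ q

  _∎ : ∀ {w v} (f : Mor w v) → f ≈m f
  f ∎ = ≈m-refl

  -- Abstract, so that unification never unfolds the interpretation of a composite.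
  abstract
    infixl 9 _▸_
    _▸_ : ∀ {u v w} → Mor u v → Mor v w → Mor u w
    f ▸ g = ⌜ un f ⨾ un g ⌝

    𝕀 : ∀ w → Mor w w
    𝕀 w = ⌜ id ⌝

    infixr 10 _⊗m_
    _⊗m_ : ∀ {w v w′ v′} → Mor w v → Mor w′ v′ → Mor (w ++ w′) (v ++ v′)
    _⊗m_ {w} {v} {w′} {v′} f g = ⌜ coe (⟦++⟧ w w′) ⨾ (un f ⊗₁ un g) ⨾ coe (sym (⟦++⟧ v v′)) ⌝

    σm : ∀ w v → Mor (w ++ v) (v ++ w)
    σm w v = ⌜ coe (⟦++⟧ w v) ⨾ σ ⟦ w ⟧ ⟦ v ⟧ ⨾ coe (sym (⟦++⟧ v w)) ⌝

    σ⁻m : ∀ w v → Mor (v ++ w) (w ++ v)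
    σ⁻m w v = ⌜ coe (⟦++⟧ v w) ⨾ σ⁻¹ ⟦ w ⟧ ⟦ v ⟧ ⨾ coe (sym (⟦++⟧ w v)) ⌝

    θm : ∀ w → Mor w w
    θm w = ⌜ θ ⟦ w ⟧ ⌝

    θ⁻m : ∀ w → Mor w w
    θ⁻m w = ⌜ θ⁻¹ ⟦ w ⟧ ⌝

    un-▸ : ∀ {u v w} (f : Mor u v) (g : Mor v w) → un (f ▸ g) ≋ un f ⨾ un g
    un-▸ f g = ≋-refl

    un-𝕀 : ∀ {w} → un (𝕀 w) ≋ id {⟦ w ⟧}
    un-𝕀 = ≋-refl

    un-θm : ∀ {w} → un (θm w) ≋ θ ⟦ w ⟧
    un-θm = ≋-refl

    un-θ⁻m : ∀ {w} → un (θ⁻m w) ≋ θ⁻¹ ⟦ w ⟧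
    un-θ⁻m = ≋-refl

    un-⊗m : ∀ {w v w′ v′} (f : Mor w v) (g : Mor w′ v′) → un (f ⊗m g) ≋ un f ⊗₁ un g
    un-⊗m {w} {v} {w′} {v′} f g =
      coe-elimʳ (sym (⟦++⟧ v v′)) (coe-elimˡ (⟦++⟧ w w′) ≋-refl)

    un-σm : ∀ w v → un (σm w v) ≋ σ ⟦ w ⟧ ⟦ v ⟧
    un-σm w v = coe-elimʳ (sym (⟦++⟧ v w)) (coe-elimˡ (⟦++⟧ w v) ≋-refl)

    un-σ⁻m : ∀ w v → un (σ⁻m w v) ≋ σ⁻¹ ⟦ w ⟧ ⟦ v ⟧
    un-σ⁻m w v = coe-elimʳ (sym (⟦++⟧ w v)) (coe-elimˡ (⟦++⟧ v w) ≋-refl)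

    ▸-resp : ∀ {u v w} {f f′ : Mor u v} {g g′ : Mor v w} → f ≈m f′ → g ≈m g′ → f ▸ g ≈m f′ ▸ g′
    ▸-resp (mk p) (mk q) = mk (⨾-resp-≈ p q)

    ▸-assoc : ∀ {u v w x} {f : Mor u v} {g : Mor v w} {h : Mor w x} → (f ▸ g) ▸ h ≈m f ▸ (g ▸ h)
    ▸-assoc = mk ⨾-assoc

    ▸-identityˡ : ∀ {u v} {f : Mor u v} → 𝕀 u ▸ f ≈m f
    ▸-identityˡ = mk identityˡ

    ▸-identityʳ : ∀ {u v} {f : Mor u v} → f ▸ 𝕀 v ≈m f
    ▸-identityʳ = mk identityʳ

    ⊗m-resp : ∀ {w v w′ v′} {f f′ : Mor w v} {g g′ : Mor w′ v′} → f ≈m f′ → g ≈m g′ → f ⊗m g ≈m f′ ⊗m g′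
    ⊗m-resp (mk p) (mk q) = mk (⨾-resp-≈ (⨾-resp-≈ ≈.refl (⊗-resp-≈ p q)) ≈.refl)

    θm-natural : ∀ {w v} {f : Mor w v} → f ▸ θm v ≈m θm w ▸ f
    θm-natural = mk θ-natural

    θm-θ⁻m : ∀ w → θm w ▸ θ⁻m w ≈m 𝕀 w
    θm-θ⁻m w = mk θ-θ⁻¹

    θ⁻m-θm : ∀ w → θ⁻m w ▸ θm w ≈m 𝕀 w
    θ⁻m-θm w = mk θ⁻¹-θ

  infixr 4 _⟩▸⟨_ refl⟩▸⟨_ _⟩⊗⟨_ refl⟩⊗⟨_
  infixl 4 _⟩▸⟨refl _⟩⊗⟨refl

  _⟩▸⟨_ : ∀ {u v w} {f f′ : Mor u v} {g g′ : Mor v w} → f ≈m f′ → g ≈m g′ → f ▸ g ≈m f′ ▸ g′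
  _⟩▸⟨_ = ▸-resp

  refl⟩▸⟨_ : ∀ {u v w} {f : Mor u v} {g g′ : Mor v w} → g ≈m g′ → f ▸ g ≈m f ▸ g′
  refl⟩▸⟨ q = ▸-resp ≈m-refl q

  _⟩▸⟨refl : ∀ {u v w} {f f′ : Mor u v} {g : Mor v w} → f ≈m f′ → f ▸ g ≈m f′ ▸ g
  p ⟩▸⟨refl = ▸-resp p ≈m-refl

  _⟩⊗⟨_ : ∀ {w v w′ v′} {f f′ : Mor w v} {g g′ : Mor w′ v′} → f ≈m f′ → g ≈m g′ → f ⊗m g ≈m f′ ⊗m g′
  _⟩⊗⟨_ = ⊗m-resp

  refl⟩⊗⟨_ : ∀ {w v w′ v′} {f : Mor w v} {g g′ : Mor w′ v′} → g ≈m g′ → f ⊗m g ≈m f ⊗m g′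
  refl⟩⊗⟨ q = ⊗m-resp ≈m-refl q

  _⟩⊗⟨refl : ∀ {w v w′ v′} {f f′ : Mor w v} {g : Mor w′ v′} → f ≈m f′ → f ⊗m g ≈m f′ ⊗m g
  p ⟩⊗⟨refl = ⊗m-resp p ≈m-refl

  ▸-assoc˘ : ∀ {u v w x} {f : Mor u v} {g : Mor v w} {h : Mor w x} → f ▸ (g ▸ h) ≈m (f ▸ g) ▸ h
  ▸-assoc˘ = ≈m-sym ▸-assoc

  interchange : ∀ {u v w u′ v′ w′} {f : Mor u v} {g : Mor v w} {h : Mor u′ v′} {k : Mor v′ w′} →
                (f ▸ g) ⊗m (h ▸ k) ≈m (f ⊗m h) ▸ (g ⊗m k)
  interchange {f = f} {g} {h} {k} = ≋⇒≈m
    (≋-trans (un-⊗m (f ▸ g) (h ▸ k))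
    (≋-trans (⊗-resp-≋ (un-▸ f g) (un-▸ h k))
    (≋-trans (≈⇒≋ ⊗-⨾)
    (≋-sym (≋-trans (un-▸ _ _) (⨾-resp-≋ (un-⊗m f h) (un-⊗m g k)))))))

  𝕀⊗𝕀 : ∀ {w v} → 𝕀 w ⊗m 𝕀 v ≈m 𝕀 (w ++ v)
  𝕀⊗𝕀 {w} {v} = ≋⇒≈m
    (≋-trans (un-⊗m (𝕀 w) (𝕀 v)) (≋-trans (⊗-resp-≋ un-𝕀 un-𝕀)
    (≋-trans (≈⇒≋ ⊗-id) (≋-trans (id≋id (sym (⟦++⟧ w v))) (≋-sym un-𝕀)))))

  ⊗m-assoc : ∀ {w₁ v₁ w₂ v₂ w₃ v₃} (f : Mor w₁ v₁) (g : Mor w₂ v₂) (h : Mor w₃ v₃) →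
             un ((f ⊗m g) ⊗m h) ≋ un (f ⊗m (g ⊗m h))
  ⊗m-assoc f g h =
    ≋-trans (un-⊗m (f ⊗m g) h) (≋-trans (⊗-resp-≋ (un-⊗m f g) ≋-refl) (≋-trans ⊗-assoc≋
      (≋-sym (≋-trans (un-⊗m f (g ⊗m h)) (⊗-resp-≋ ≋-refl (un-⊗m g h))))))

  ⊗m-unitˡ : ∀ {w v} (f : Mor w v) → 𝕀 [] ⊗m f ≈m f
  ⊗m-unitˡ f = ≋⇒≈m (≋-trans (un-⊗m (𝕀 []) f) (≋-trans (⊗-resp-≋ un-𝕀 ≋-refl) ⊗-unitˡ≋))

  ⊗m-unitʳ : ∀ {w v} (f : Mor w v) → un (f ⊗m 𝕀 []) ≋ un f
  ⊗m-unitʳ f = ≋-trans (un-⊗m f (𝕀 [])) (≋-trans (⊗-resp-≋ ≋-refl un-𝕀) ⊗-unitʳ≋)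

  serialiseˡ : ∀ {w v w′ v′} {f : Mor w v} {g : Mor w′ v′} → (f ⊗m 𝕀 w′) ▸ (𝕀 v ⊗m g) ≈m f ⊗m g
  serialiseˡ = ≈m-sym (≈m-sym ▸-identityʳ ⟩⊗⟨ ≈m-sym ▸-identityˡ ⟫ interchange)

  serialiseʳ : ∀ {w v w′ v′} {f : Mor w v} {g : Mor w′ v′} → (𝕀 w ⊗m g) ▸ (f ⊗m 𝕀 v′) ≈m f ⊗m g
  serialiseʳ = ≈m-sym (≈m-sym ▸-identityˡ ⟩⊗⟨ ≈m-sym ▸-identityʳ ⟫ interchange)

  ▸-⊗𝕀 : ∀ {u v w} {f : Mor u v} {g : Mor v w} x → (f ▸ g) ⊗m 𝕀 x ≈m (f ⊗m 𝕀 x) ▸ (g ⊗m 𝕀 x)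
  ▸-⊗𝕀 x = refl⟩⊗⟨ ≈m-sym ▸-identityˡ ⟫ interchange

  𝕀⊗-▸ : ∀ {u v w} {f : Mor u v} {g : Mor v w} x → 𝕀 x ⊗m (f ▸ g) ≈m (𝕀 x ⊗m f) ▸ (𝕀 x ⊗m g)
  𝕀⊗-▸ x = ≈m-sym ▸-identityˡ ⟩⊗⟨refl ⟫ interchange

  σ⁻¹-natural : ∀ {X Y X′ Y′} {f : Hom X X′} {g : Hom Y Y′} → (g ⊗₁ f) ⨾ σ⁻¹ X′ Y′ ≈ σ⁻¹ X Y ⨾ (f ⊗₁ g)
  σ⁻¹-natural = ≈.trans (≈.sym identityˡ) (≈.trans (⨾-resp-≈ (≈.sym σ⁻¹-σ) ≈.refl)
    (≈.trans ⨾-assoc (⨾-resp-≈ ≈.refl (≈.trans (≈.sym ⨾-assoc) (≈.trans (⨾-resp-≈ (≈.sym σ-natural) ≈.refl)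
    (≈.trans ⨾-assoc (≈.trans (⨾-resp-≈ ≈.refl σ-σ⁻¹) identityʳ)))))))

  σm-natural : ∀ {w v w′ v′} {f : Mor w v} {g : Mor w′ v′} → (f ⊗m g) ▸ σm v v′ ≈m σm w w′ ▸ (g ⊗m f)
  σm-natural {w} {v} {w′} {v′} {f} {g} = ≋⇒≈m
    (≋-trans (un-▸ _ _) (≋-trans (⨾-resp-≋ (un-⊗m f g) (un-σm v v′)) (≋-trans (≈⇒≋ σ-natural)
    (≋-sym (≋-trans (un-▸ _ _) (⨾-resp-≋ (un-σm w w′) (un-⊗m g f)))))))

  σ⁻m-natural : ∀ {w v w′ v′} {f : Mor w v} {g : Mor w′ v′} → (g ⊗m f) ▸ σ⁻m v v′ ≈m σ⁻m w w′ ▸ (f ⊗m g)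
  σ⁻m-natural {w} {v} {w′} {v′} {f} {g} = ≋⇒≈m
    (≋-trans (un-▸ _ _) (≋-trans (⨾-resp-≋ (un-⊗m g f) (un-σ⁻m v v′)) (≋-trans (≈⇒≋ σ⁻¹-natural)
    (≋-sym (≋-trans (un-▸ _ _) (⨾-resp-≋ (un-σ⁻m w w′) (un-⊗m f g)))))))

  θ⁻m-natural : ∀ {w v} {f : Mor w v} → f ▸ θ⁻m v ≈m θ⁻m w ▸ f
  θ⁻m-natural {w} {v} =
    (≈m-sym ▸-identityˡ ⟫ ≈m-sym (θ⁻m-θm w) ⟩▸⟨refl ⟫ ▸-assoc ⟫ refl⟩▸⟨ ≈m-sym θm-natural) ⟩▸⟨refl
    ⟫ ▸-assoc ⟫ refl⟩▸⟨ (▸-assoc ⟫ refl⟩▸⟨ θm-θ⁻m v ⟫ ▸-identityʳ)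

  σm-σ⁻m : ∀ w v → σm w v ▸ σ⁻m w v ≈m 𝕀 (w ++ v)
  σm-σ⁻m w v = ≋⇒≈m (≋-trans (un-▸ _ _) (≋-trans (⨾-resp-≋ (un-σm w v) (un-σ⁻m w v))
    (≋-trans (≈⇒≋ σ-σ⁻¹) (≋-trans (id≋id (sym (⟦++⟧ w v))) (≋-sym un-𝕀)))))

  σ⁻m-σm : ∀ w v → σ⁻m w v ▸ σm w v ≈m 𝕀 (v ++ w)
  σ⁻m-σm w v = ≋⇒≈m (≋-trans (un-▸ _ _) (≋-trans (⨾-resp-≋ (un-σ⁻m w v) (un-σm w v))
    (≋-trans (≈⇒≋ σ⁻¹-σ) (≋-trans (id≋id (sym (⟦++⟧ v w))) (≋-sym un-𝕀)))))

  θm-++ : ∀ w v → θm (w ++ v) ≈m σm w v ▸ (θm v ⊗m θm w) ▸ σm v w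
  θm-++ w v = ≋⇒≈m (≋-trans un-θm (≋-trans (θ-cong≋ (⟦++⟧ w v)) (≋-trans (≈⇒≋ θ-⊗)
    (≋-sym (≋-trans (un-▸ _ _) (⨾-resp-≋ (≋-trans (un-▸ _ _) (⨾-resp-≋ (un-σm w v)
    (≋-trans (un-⊗m (θm v) (θm w)) (⊗-resp-≋ un-θm un-θm)))) (un-σm v w)))))))

  𝕀≋𝕀 : ∀ {w v} → ⟦ w ⟧ ≡ ⟦ v ⟧ → un (𝕀 w) ≋ un (𝕀 v)
  𝕀≋𝕀 p = ≋-trans un-𝕀 (≋-trans (id≋id p) (≋-sym un-𝕀))

  id⊗-⨾ : ∀ {X Y Z W} {f : Hom Y Z} {g : Hom Z W} → id {X} ⊗₁ (f ⨾ g) ≈ (id ⊗₁ f) ⨾ (id ⊗₁ g)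
  id⊗-⨾ = ≈.trans (⊗-resp-≈ (≈.sym identityˡ) ≈.refl) ⊗-⨾

  ηm : ∀ X → Mor [] (X ∷ X * ∷ [])
  ηm X = ⌜ η X ⌝

  εm : ∀ X → Mor (X * ∷ X ∷ []) []
  εm X = ⌜ ε X ⌝

  snake₁m : ∀ X → (ηm X ⊗m 𝕀 (X ∷ [])) ▸ (𝕀 (X ∷ []) ⊗m εm X) ≈m 𝕀 (X ∷ [])
  snake₁m X = ≋⇒≈m (≋-trans (un-▸ _ _) (≋-trans (≋-sym (coe-elimʳ unitʳ₀ (coe-elimᵐ ⊗-assoc₀
    (coe-elimˡ (sym unitˡ₀) (≋-sym (≋-trans (un-⊗m (ηm X) (𝕀 _)) (⊗-resp-≋ ≋-refl un-𝕀))))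
    (≋-sym (≋-trans (un-⊗m (𝕀 _) (εm X)) (⊗-resp-≋ un-𝕀 ≋-refl))))))
    (≋-trans (≈⇒≋ snake₁) (≋-sym un-𝕀))))

  snake₂m : ∀ X → (𝕀 (X * ∷ []) ⊗m ηm X) ▸ (εm X ⊗m 𝕀 (X * ∷ [])) ≈m 𝕀 (X * ∷ [])
  snake₂m X = ≋⇒≈m (≋-trans (un-▸ _ _) (≋-trans (≋-sym (coe-elimʳ unitˡ₀ (coe-elimᵐ (sym ⊗-assoc₀)
    (coe-elimˡ (sym unitʳ₀) (≋-sym (≋-trans (un-⊗m (𝕀 _) (ηm X)) (⊗-resp-≋ un-𝕀 ≋-refl))))
    (≋-sym (≋-trans (un-⊗m (εm X) (𝕀 _)) (⊗-resp-≋ ≋-refl un-𝕀))))))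
    (≋-trans (≈⇒≋ snake₂) (≋-sym un-𝕀))))

  θ-dualm : ∀ X → (𝕀 (X * ∷ []) ⊗m ηm X) ▸ (𝕀 (X * ∷ []) ⊗m (θm (X ∷ []) ⊗m 𝕀 (X * ∷ [])))
                    ▸ (εm X ⊗m 𝕀 (X * ∷ [])) ≈m θm (X * ∷ [])
  θ-dualm X = ≋⇒≈m (≋-trans (un-▸ _ _) (≋-trans (⨾-resp-≋ (un-▸ _ _) ≋-refl) (≋-trans
    (≋-sym (coe-elimʳ unitˡ₀ (coe-elimᵐ (sym ⊗-assoc₀) (⨾-resp-≋
    (coe-elimˡ (sym unitʳ₀) (≋-sym (≋-trans (un-⊗m (𝕀 _) (ηm X)) (⊗-resp-≋ un-𝕀 ≋-refl))))
    (≋-sym (≋-trans (un-⊗m (𝕀 _) (θm _ ⊗m 𝕀 _))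
    (⊗-resp-≋ un-𝕀 (≋-trans (un-⊗m (θm _) (𝕀 _)) (⊗-resp-≋ un-θm un-𝕀))))))
    (≋-sym (≋-trans (un-⊗m (εm X) (𝕀 _)) (⊗-resp-≋ ≋-refl un-𝕀))))))
    (≋-trans (≈⇒≋ θ-dual) (≋-sym un-θm)))))

  -- Both follow from the hexagon with a unit factor: σ 𝟙 X is an idempotent isomorphism.
  σ-unitˡ : ∀ {X} → σ 𝟙 X ≋ id {X}
  σ-unitˡ {X} = ≋-trans (≋-sym id≋σ) (id≋id unitˡ₀)
    where
      q : X ⊗₀ 𝟙 ≡ 𝟙 ⊗₀ X
      q = trans unitʳ₀ (sym unitˡ₀)
      idempotent : σ 𝟙 X ≋ σ 𝟙 X ⨾ coe q ⨾ σ 𝟙 X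
      idempotent = ≋-trans (σ-cong≋ (sym unitˡ₀) refl) (≋-trans (≈⇒≋ hexagon₂)
        (coe-elimʳ ⊗-assoc₀ (⨾coe⨾-resp-≋ (sym ⊗-assoc₀) q (coe-elimˡ ⊗-assoc₀ ⊗-unitˡ≋) ⊗-unitʳ≋)))
      id≋σ : id {𝟙 ⊗₀ X} ≋ σ 𝟙 X
      id≋σ = ≋-trans (≈⇒≋ (≈.sym σ-σ⁻¹)) (≋-trans (⨾-resp-≋ idempotent ≋-refl)
        (≋-trans (≈⇒≋ (≈.trans ⨾-assoc (≈.trans (⨾-resp-≈ ≈.refl σ-σ⁻¹) identityʳ))) (coe-elimʳ q ≋-refl)))

  σ-unitʳ : ∀ {X} → σ X 𝟙 ≋ id {X}
  σ-unitʳ {X} = ≋-trans (≋-sym id≋σ) (id≋id unitʳ₀)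
    where
      q : 𝟙 ⊗₀ X ≡ X ⊗₀ 𝟙
      q = trans unitˡ₀ (sym unitʳ₀)
      idempotent : σ X 𝟙 ≋ σ X 𝟙 ⨾ coe q ⨾ σ X 𝟙
      idempotent = ≋-trans (σ-cong≋ refl (sym unitˡ₀)) (≋-trans (≈⇒≋ hexagon₁)
        (coe-elimʳ (sym ⊗-assoc₀) (⨾coe⨾-resp-≋ ⊗-assoc₀ q (coe-elimˡ (sym ⊗-assoc₀) ⊗-unitʳ≋) ⊗-unitˡ≋)))
      id≋σ : id {X ⊗₀ 𝟙} ≋ σ X 𝟙
      id≋σ = ≋-trans (≈⇒≋ (≈.sym σ-σ⁻¹)) (≋-trans (⨾-resp-≋ idempotent ≋-refl)
        (≋-trans (≈⇒≋ (≈.trans ⨾-assoc (≈.trans (⨾-resp-≈ ≈.refl σ-σ⁻¹) identityʳ))) (coe-elimʳ q ≋-refl)))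

  left-inverse-of-≋id : ∀ {X Y Z} {s : Hom X Y} {t : Hom Y X} → s ≋ id {Z} → t ⨾ s ≈ id → t ≋ id {Y}
  left-inverse-of-≋id p@(mk≋ refl _ _) e = ≋-trans (≋-sym (≋id-elimʳ p)) (≈⇒≋ e)

  σ⁻¹-unitʳ : ∀ {X} → σ⁻¹ X 𝟙 ≋ id {X}
  σ⁻¹-unitʳ = ≋-trans (left-inverse-of-≋id σ-unitʳ σ⁻¹-σ) (id≋id unitˡ₀)

  -- θ 𝟙 = σ ⨾ (θ 𝟙 ⊗ θ 𝟙) ⨾ σ = θ 𝟙 ⨾ θ 𝟙 is an invertible idempotent.
  θ-unit : θ 𝟙 ≈ id
  θ-unit = ≈.sym (≈.trans (≈.sym θ⁻¹-θ) (≈.trans (⨾-resp-≈ ≈.refl (≋⇒≈ idempotent))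
    (≈.trans (≈.sym ⨾-assoc) (≈.trans (⨾-resp-≈ θ⁻¹-θ ≈.refl) identityˡ))))
    where
      idempotent : θ 𝟙 ≋ θ 𝟙 ⨾ θ 𝟙
      idempotent = ≋-trans (θ-cong≋ (sym unitˡ₀)) (≋-trans (≈⇒≋ θ-⊗)
        (≋-trans (⨾-resp-≋ (⨾-resp-≋ σ-unitˡ
        (≋-trans (≈⇒≋ (≈.trans (⊗-resp-≈ (≈.sym identityʳ) (≈.sym identityˡ)) ⊗-⨾))
        (⨾-resp-≋ ⊗-unitʳ≋ ⊗-unitˡ≋))) σ-unitˡ)
        (≋-trans (⨾-resp-≋ (≈⇒≋ identityˡ) ≋-refl) (≈⇒≋ identityʳ))))

  θm-[] : θm [] ≈m 𝕀 []
  θm-[] = ≋⇒≈m (≋-trans un-θm (≋-trans (≈⇒≋ θ-unit) (≋-sym un-𝕀)))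

  un-σ⁻m-[]ʳ : ∀ w → un (σ⁻m w []) ≋ id {⟦ w ⟧}
  un-σ⁻m-[]ʳ w = ≋-trans (un-σ⁻m w []) σ⁻¹-unitʳ

  -- P is refl whenever the words are concrete.
  hexagon₁-≋ : ∀ w v u (P : ⟦ (v ++ w) ++ u ⟧ ≡ ⟦ v ++ (w ++ u) ⟧) →
               un (σm w (v ++ u)) ≋ un (σm w v ⊗m 𝕀 u) ⨾ coe P ⨾ un (𝕀 v ⊗m σm w u)
  hexagon₁-≋ w v u P = ≋-trans (un-σm w (v ++ u)) (≋-trans (σ-cong≋ refl (⟦++⟧ v u)) (≋-trans (≈⇒≋ hexagon₁)
    (coe-elimʳ (sym ⊗-assoc₀) (⨾coe⨾-resp-≋ ⊗-assoc₀ P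
    (coe-elimˡ (sym ⊗-assoc₀) (≋-sym (≋-trans (un-⊗m _ _) (⊗-resp-≋ (un-σm w v) un-𝕀))))
    (≋-sym (≋-trans (un-⊗m _ _) (⊗-resp-≋ un-𝕀 (un-σm w u))))))))

  hexagon₂-≋ : ∀ w w′ v (P : ⟦ w ++ (v ++ w′) ⟧ ≡ ⟦ (w ++ v) ++ w′ ⟧) →
               un (σm (w ++ w′) v) ≋ un (𝕀 w ⊗m σm w′ v) ⨾ coe P ⨾ un (σm w v ⊗m 𝕀 w′)
  hexagon₂-≋ w w′ v P = ≋-trans (un-σm (w ++ w′) v)
    (≋-trans (σ-cong≋ (⟦++⟧ w w′) refl) (≋-trans (≈⇒≋ hexagon₂)
    (coe-elimʳ ⊗-assoc₀ (⨾coe⨾-resp-≋ (sym ⊗-assoc₀) P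
    (coe-elimˡ ⊗-assoc₀ (≋-sym (≋-trans (un-⊗m _ _) (⊗-resp-≋ un-𝕀 (un-σm w′ v)))))
    (≋-sym (≋-trans (un-⊗m _ _) (⊗-resp-≋ (un-σm w v) un-𝕀)))))))

  ≈m-split : ∀ {u v w} {h : Mor u w} {f : Mor u v} {g : Mor v w} →
             un h ≋ un f ⨾ coe refl ⨾ un g → h ≈m f ▸ g
  ≈m-split p = ≋⇒≈m (≋-trans p (≋-trans (coe-elimᵐ refl ≋-refl ≋-refl) (≋-sym (un-▸ _ _))))

  σm-absorbs-stateˡ : ∀ {u} w (s : Mor [] u) → un ((s ⊗m 𝕀 w) ▸ σm u w) ≋ un (𝕀 w ⊗m s)
  σm-absorbs-stateˡ w s = ≋-trans (≈⇒≋ (pf σm-natural))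
    (≋-trans (un-▸ _ _) (≋id-elimˡ (≋-trans (un-σm [] w) σ-unitˡ)))

  σm-absorbs-stateʳ : ∀ {u} w (s : Mor [] u) → un ((𝕀 w ⊗m s) ▸ σm w u) ≋ un (s ⊗m 𝕀 w)
  σm-absorbs-stateʳ w s = ≋-trans (≈⇒≋ (pf σm-natural))
    (≋-trans (un-▸ _ _) (≋id-elimˡ (≋-trans (un-σm w []) σ-unitʳ)))

  state-commutes : ∀ {u w v} (s : Mor [] u) (f : Mor w v) → (s ⊗m 𝕀 w) ▸ (𝕀 u ⊗m f) ≈m f ▸ (s ⊗m 𝕀 v)
  state-commutes s f = serialiseˡ ⟫ ≈m-sym serialiseʳ ⟫ ⊗m-unitˡ f ⟩▸⟨refl

  module Cups (X : Obj) where
    𝕏 𝕏* 𝕏𝕏* 𝕏*𝕏 : List Obj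
    𝕏    = X ∷ []
    𝕏*   = X * ∷ []
    𝕏𝕏* = X ∷ X * ∷ []
    𝕏*𝕏 = X * ∷ X ∷ []

    θ𝕏 θ⁻𝕏 : Mor 𝕏 𝕏
    θ𝕏  = θm 𝕏
    θ⁻𝕏 = θ⁻m 𝕏

    θ𝕏* θ⁻𝕏* : Mor 𝕏* 𝕏*
    θ𝕏*  = θm 𝕏*
    θ⁻𝕏* = θ⁻m 𝕏*

    cup : Mor [] 𝕏𝕏*
    cup = ηm X

    cap : Mor 𝕏*𝕏 []
    cap = εm X

    -- cup′ and cap′ exhibit X as a dual of X*, through the braiding and the twist;
    -- cap′ is the cap that closes the loop in `trace`.
    cup′ : Mor [] 𝕏*𝕏
    cup′ = cup ▸ (𝕀 𝕏 ⊗m θ⁻𝕏*) ▸ σ⁻m 𝕏* 𝕏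

    cap′ : Mor 𝕏𝕏* []
    cap′ = σm 𝕏 𝕏* ▸ (𝕀 𝕏* ⊗m θ𝕏) ▸ cap

    un-cup′ : un cup′ ≋ η X ⨾ (id {X} ⊗₁ θ⁻¹ (X *)) ⨾ σ⁻¹ (X *) X
    un-cup′ = ≋-trans (un-▸ _ _) (⨾-resp-≋ (≋-trans (un-▸ _ _)
      (⨾-resp-≋ ≋-refl (≋-trans (un-⊗m _ _) (⊗-resp-≋ un-𝕀 un-θ⁻m)))) (un-σ⁻m 𝕏* 𝕏))

    un-cap′ : un cap′ ≋ σ X (X *) ⨾ (id {X *} ⊗₁ θ X) ⨾ ε X
    un-cap′ = ≋-trans (un-▸ _ _) (⨾-resp-≋ (≋-trans (un-▸ _ _)
      (⨾-resp-≋ (un-σm 𝕏 𝕏*) (≋-trans (un-⊗m _ _) (⊗-resp-≋ un-𝕀 un-θm)))) ≋-refl)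

    θ-slides-along-cup : cup ▸ (𝕀 𝕏 ⊗m θ𝕏*) ≈m cup ▸ (θ𝕏 ⊗m 𝕀 𝕏*)
    θ-slides-along-cup = begin
        cup ▸ (𝕀 𝕏 ⊗m θ𝕏*)
      ≈⟨ refl⟩▸⟨ (refl⟩⊗⟨ ≈m-sym (θ-dualm X)) ⟩
        cup ▸ (𝕀 𝕏 ⊗m ((𝕀 𝕏* ⊗m cup) ▸ (𝕀 𝕏* ⊗m Tθ) ▸ (cap ⊗m 𝕀 𝕏*)))
      ≈⟨ refl⟩▸⟨ (𝕀⊗-▸ 𝕏 ⟫ 𝕀⊗-▸ 𝕏 ⟩▸⟨refl) ⟩
        cup ▸ ((𝕀 𝕏 ⊗m (𝕀 𝕏* ⊗m cup)) ▸ (𝕀 𝕏 ⊗m (𝕀 𝕏* ⊗m Tθ)) ▸ (𝕀 𝕏 ⊗m (cap ⊗m 𝕀 𝕏*)))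
      ≈⟨ refl⟩▸⟨ (((≈m-sym (≋⇒≈m (⊗m-assoc (𝕀 𝕏) (𝕀 𝕏*) cup))
         ⟫ 𝕀⊗𝕀 ⟩⊗⟨refl) ⟩▸⟨ (≈m-sym (≋⇒≈m (⊗m-assoc (𝕀 𝕏) (𝕀 𝕏*) Tθ)) ⟫ 𝕀⊗𝕀 ⟩⊗⟨refl)) ⟩▸⟨ ≈m-sym
         (≋⇒≈m (⊗m-assoc (𝕀 𝕏) cap (𝕀 𝕏*)))) ⟩
        cup ▸ ((𝕀 𝕏𝕏* ⊗m cup) ▸ (𝕀 𝕏𝕏* ⊗m Tθ) ▸ ((𝕀 𝕏 ⊗m cap) ⊗m 𝕀 𝕏*))
      ≈⟨ ▸-assoc˘ ⟫ ▸-assoc˘ ⟩▸⟨refl ⟩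
        cup ▸ (𝕀 𝕏𝕏* ⊗m cup) ▸ (𝕀 𝕏𝕏* ⊗m Tθ) ▸ ((𝕀 𝕏 ⊗m cap) ⊗m 𝕀 𝕏*)
      ≈⟨ ((≈m-sym (≋⇒≈m (⊗m-unitʳ cup)) ⟩▸⟨refl ⟫ serialiseˡ ⟫ ≈m-sym serialiseʳ
         ⟫ ⊗m-unitˡ cup ⟩▸⟨refl) ⟩▸⟨refl) ⟩▸⟨refl ⟩
        cup ▸ (cup ⊗m 𝕀 𝕏𝕏*) ▸ (𝕀 𝕏𝕏* ⊗m Tθ) ▸ ((𝕀 𝕏 ⊗m cap) ⊗m 𝕀 𝕏*)
      ≈⟨ (▸-assoc ⟫ refl⟩▸⟨ state-commutes cup Tθ ⟫ ▸-assoc˘) ⟩▸⟨refl ⟩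
        cup ▸ Tθ ▸ (cup ⊗m 𝕀 𝕏𝕏*) ▸ ((𝕀 𝕏 ⊗m cap) ⊗m 𝕀 𝕏*)
      ≈⟨ ▸-assoc ⟫ refl⟩▸⟨ ((≈m-sym (refl⟩⊗⟨ 𝕀⊗𝕀) ⟫ ≈m-sym (≋⇒≈m (⊗m-assoc cup (𝕀 𝕏) (𝕀 𝕏*)))) ⟩▸⟨refl
         ⟫ ≈m-sym (▸-⊗𝕀 𝕏*)) ⟩
        cup ▸ Tθ ▸ (((cup ⊗m 𝕀 𝕏) ▸ (𝕀 𝕏 ⊗m cap)) ⊗m 𝕀 𝕏*)
      ≈⟨ refl⟩▸⟨ (snake₁m X ⟩⊗⟨refl ⟫ 𝕀⊗𝕀) ⟫ ▸-identityʳ ⟩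
        cup ▸ Tθ
      ∎
      where
        Tθ : Mor 𝕏𝕏* 𝕏𝕏*
        Tθ = θ𝕏 ⊗m 𝕀 𝕏*

    cup-absorbs-θ⊗θ⁻ : cup ▸ (θ𝕏 ⊗m θ⁻𝕏*) ≈m cup
    cup-absorbs-θ⊗θ⁻ = begin
        cup ▸ (θ𝕏 ⊗m θ⁻𝕏*)
      ≈⟨ refl⟩▸⟨ ≈m-sym serialiseˡ ⟫ ▸-assoc˘ ⟩
        cup ▸ (θ𝕏 ⊗m 𝕀 𝕏*) ▸ (𝕀 𝕏 ⊗m θ⁻𝕏*)
      ≈⟨ ≈m-sym θ-slides-along-cup ⟩▸⟨refl ⟩
        cup ▸ (𝕀 𝕏 ⊗m θ𝕏*) ▸ (𝕀 𝕏 ⊗m θ⁻𝕏*)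
      ≈⟨ ▸-assoc ⟫ refl⟩▸⟨ (≈m-sym (𝕀⊗-▸ 𝕏) ⟫ refl⟩⊗⟨ θm-θ⁻m 𝕏* ⟫ 𝕀⊗𝕀) ⟫ ▸-identityʳ ⟩
        cup
      ∎

    θ⁻-slides-along-cup : cup ▸ (θ⁻𝕏 ⊗m 𝕀 𝕏*) ≈m cup ▸ (𝕀 𝕏 ⊗m θ⁻𝕏*)
    θ⁻-slides-along-cup = begin
        cup ▸ (θ⁻𝕏 ⊗m 𝕀 𝕏*)
      ≈⟨ ≈m-sym cup-absorbs-θ⊗θ⁻ ⟩▸⟨refl ⟩
        cup ▸ (θ𝕏 ⊗m θ⁻𝕏*) ▸ (θ⁻𝕏 ⊗m 𝕀 𝕏*)
      ≈⟨ ▸-assoc ⟫ refl⟩▸⟨ (≈m-sym interchange ⟫ θm-θ⁻m 𝕏 ⟩⊗⟨ ▸-identityʳ) ⟩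
        cup ▸ (𝕀 𝕏 ⊗m θ⁻𝕏*)
      ∎

    cup′-untwist : cup′ ▸ σm 𝕏* 𝕏 ▸ (θ𝕏 ⊗m 𝕀 𝕏*) ≈m cup
    cup′-untwist = begin
        cup′ ▸ σm 𝕏* 𝕏 ▸ (θ𝕏 ⊗m 𝕀 𝕏*)
      ≈⟨ (▸-assoc ⟫ refl⟩▸⟨ σ⁻m-σm 𝕏* 𝕏 ⟫ ▸-identityʳ) ⟩▸⟨refl ⟩
        cup ▸ (𝕀 𝕏 ⊗m θ⁻𝕏*) ▸ (θ𝕏 ⊗m 𝕀 𝕏*)
      ≈⟨ ≈m-sym θ⁻-slides-along-cup ⟩▸⟨refl ⟩
        cup ▸ (θ⁻𝕏 ⊗m 𝕀 𝕏*) ▸ (θ𝕏 ⊗m 𝕀 𝕏*)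
      ≈⟨ ▸-assoc ⟫ refl⟩▸⟨ (≈m-sym (▸-⊗𝕀 𝕏*) ⟫ θ⁻m-θm 𝕏 ⟩⊗⟨refl ⟫ 𝕀⊗𝕀) ⟫ ▸-identityʳ ⟩
        cup
      ∎

    cup-twist : cup ▸ σm 𝕏 𝕏* ▸ (θ𝕏* ⊗m 𝕀 𝕏) ≈m cup′
    cup-twist = begin
        cup ▸ σm 𝕏 𝕏* ▸ (θ𝕏* ⊗m 𝕀 𝕏)
      ≈⟨ refl⟩▸⟨ (≈m-sym (▸-identityʳ ⟩⊗⟨ θm-θ⁻m 𝕏) ⟫ interchange) ⟫ ▸-assoc˘ ⟩
        cup ▸ σm 𝕏 𝕏* ▸ (θ𝕏* ⊗m θ𝕏) ▸ (𝕀 𝕏* ⊗m θ⁻𝕏)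
      ≈⟨ twisted-cup ⟩▸⟨refl ⟩
        cup ▸ σ⁻m 𝕏* 𝕏 ▸ (𝕀 𝕏* ⊗m θ⁻𝕏)
      ≈⟨ ▸-assoc ⟫ refl⟩▸⟨ ≈m-sym σ⁻m-natural ⟫ ▸-assoc˘ ⟩
        cup ▸ (θ⁻𝕏 ⊗m 𝕀 𝕏*) ▸ σ⁻m 𝕏* 𝕏
      ≈⟨ θ⁻-slides-along-cup ⟩▸⟨refl ⟩
        cup′
      ∎
      where
        -- θ on X ⊗ X* is σ ; (θ ⊗ θ) ; σ, and θ commutes with the cup into θ 𝟙 = id.
        θ-on-cup : cup ▸ σm 𝕏 𝕏* ▸ (θ𝕏* ⊗m θ𝕏) ▸ σm 𝕏* 𝕏 ≈m cup
        θ-on-cup = ▸-assoc ⟩▸⟨refl ⟫ ▸-assoc ⟫ refl⟩▸⟨ ≈m-sym (θm-++ 𝕏 𝕏*) ⟫ θm-natural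
          ⟫ θm-[] ⟩▸⟨refl ⟫ ▸-identityˡ
        twisted-cup : cup ▸ σm 𝕏 𝕏* ▸ (θ𝕏* ⊗m θ𝕏) ≈m cup ▸ σ⁻m 𝕏* 𝕏
        twisted-cup = ≈m-sym ▸-identityʳ ⟫ refl⟩▸⟨ ≈m-sym (σm-σ⁻m 𝕏* 𝕏) ⟫ ▸-assoc˘ ⟫ θ-on-cup ⟩▸⟨refl

    curl≈θ : (𝕀 𝕏 ⊗m cup) ▸ (σm 𝕏 𝕏 ⊗m 𝕀 𝕏*) ▸ (𝕀 𝕏 ⊗m cap′) ≈m θ𝕏
    curl≈θ = begin
        (𝕀 𝕏 ⊗m cup) ▸ (σm 𝕏 𝕏 ⊗m 𝕀 𝕏*) ▸ (𝕀 𝕏 ⊗m cap′)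
      ≈⟨ refl⟩▸⟨ (𝕀⊗-▸ 𝕏 ⟫ 𝕀⊗-▸ 𝕏 ⟩▸⟨refl) ⟩
        (𝕀 𝕏 ⊗m cup) ▸ (σm 𝕏 𝕏 ⊗m 𝕀 𝕏*) ▸ ((𝕀 𝕏 ⊗m σm 𝕏 𝕏*) ▸ (𝕀 𝕏 ⊗m (𝕀 𝕏* ⊗m θ𝕏)) ▸ (𝕀 𝕏 ⊗m cap))
      ≈⟨ ▸-assoc ⟫ refl⟩▸⟨ (▸-assoc˘ ⟫ ▸-assoc˘ ⟩▸⟨refl) ⟩
        (𝕀 𝕏 ⊗m cup) ▸ ((σm 𝕏 𝕏 ⊗m 𝕀 𝕏*) ▸ (𝕀 𝕏 ⊗m σm 𝕏 𝕏*) ▸ (𝕀 𝕏 ⊗m (𝕀 𝕏* ⊗m θ𝕏)) ▸ (𝕀 𝕏 ⊗m cap))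
      ≈⟨ refl⟩▸⟨ ((≈m-sym (≈m-split (hexagon₁-≋ 𝕏 𝕏 𝕏* refl)) ⟩▸⟨refl) ⟩▸⟨refl) ⟩
        (𝕀 𝕏 ⊗m cup) ▸ (σm 𝕏 𝕏𝕏* ▸ (𝕀 𝕏 ⊗m (𝕀 𝕏* ⊗m θ𝕏)) ▸ (𝕀 𝕏 ⊗m cap))
      ≈⟨ ▸-assoc˘ ⟫ ▸-assoc˘ ⟩▸⟨refl ⟩
        (𝕀 𝕏 ⊗m cup) ▸ σm 𝕏 𝕏𝕏* ▸ (𝕀 𝕏 ⊗m (𝕀 𝕏* ⊗m θ𝕏)) ▸ (𝕀 𝕏 ⊗m cap)
      ≈⟨ (≋⇒≈m (σm-absorbs-stateʳ 𝕏 cup) ⟩▸⟨refl) ⟩▸⟨refl ⟩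
        (cup ⊗m 𝕀 𝕏) ▸ (𝕀 𝕏 ⊗m (𝕀 𝕏* ⊗m θ𝕏)) ▸ (𝕀 𝕏 ⊗m cap)
      ≈⟨ (refl⟩▸⟨ (≈m-sym (≋⇒≈m (⊗m-assoc (𝕀 𝕏) (𝕀 𝕏*) θ𝕏)) ⟫ 𝕀⊗𝕀 ⟩⊗⟨refl) ⟫ state-commutes cup θ𝕏) ⟩▸⟨refl ⟩
        θ𝕏 ▸ (cup ⊗m 𝕀 𝕏) ▸ (𝕀 𝕏 ⊗m cap)
      ≈⟨ ▸-assoc ⟫ refl⟩▸⟨ snake₁m X ⟫ ▸-identityʳ ⟩
        θ𝕏
      ∎

    cup′-θ : cup′ ▸ (𝕀 𝕏* ⊗m θ𝕏) ≈m cup ▸ σ⁻m 𝕏* 𝕏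
    cup′-θ = begin
        cup′ ▸ (𝕀 𝕏* ⊗m θ𝕏)
      ≈⟨ ▸-assoc ⟫ refl⟩▸⟨ ≈m-sym σ⁻m-natural ⟫ ▸-assoc˘ ⟩
        cup ▸ (𝕀 𝕏 ⊗m θ⁻𝕏*) ▸ (θ𝕏 ⊗m 𝕀 𝕏*) ▸ σ⁻m 𝕏* 𝕏
      ≈⟨ (▸-assoc ⟫ refl⟩▸⟨ serialiseʳ ⟫ cup-absorbs-θ⊗θ⁻) ⟩▸⟨refl ⟩
        cup ▸ σ⁻m 𝕏* 𝕏
      ∎

    snake′ : (cup′ ⊗m 𝕀 𝕏*) ▸ (𝕀 𝕏* ⊗m cap′) ≈m 𝕀 𝕏*
    snake′ = begin
        (cup′ ⊗m 𝕀 𝕏*) ▸ (𝕀 𝕏* ⊗m cap′)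
      ≈⟨ refl⟩▸⟨ (𝕀⊗-▸ 𝕏* ⟫ 𝕀⊗-▸ 𝕏* ⟩▸⟨refl) ⟩
        (cup′ ⊗m 𝕀 𝕏*) ▸ ((𝕀 𝕏* ⊗m σm 𝕏 𝕏*) ▸ (𝕀 𝕏* ⊗m (𝕀 𝕏* ⊗m θ𝕏)) ▸ (𝕀 𝕏* ⊗m cap))
      ≈⟨ refl⟩▸⟨ ((σ-split ⟩▸⟨refl) ⟩▸⟨refl) ⟩
        (cup′ ⊗m 𝕀 𝕏*) ▸ (σm 𝕏*𝕏 𝕏* ▸ (σ⁻m 𝕏* 𝕏* ⊗m 𝕀 𝕏) ▸ (𝕀 𝕏* ⊗m (𝕀 𝕏* ⊗m θ𝕏)) ▸ (𝕀 𝕏* ⊗m cap))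
      ≈⟨ ▸-assoc˘ ⟫ (▸-assoc˘ ⟫ (▸-assoc˘ ⟫ ≋⇒≈m (σm-absorbs-stateˡ 𝕏* cup′) ⟩▸⟨refl) ⟩▸⟨refl) ⟩▸⟨refl ⟩
        (𝕀 𝕏* ⊗m cup′) ▸ (σ⁻m 𝕏* 𝕏* ⊗m 𝕀 𝕏) ▸ (𝕀 𝕏* ⊗m (𝕀 𝕏* ⊗m θ𝕏)) ▸ (𝕀 𝕏* ⊗m cap)
      ≈⟨ (▸-assoc ⟫ refl⟩▸⟨ (refl⟩▸⟨ (≈m-sym (≋⇒≈m (⊗m-assoc (𝕀 𝕏*) (𝕀 𝕏*) θ𝕏)) ⟫ 𝕀⊗𝕀 ⟩⊗⟨refl) ⟫ serialiseˡ
         ⟫ ≈m-sym serialiseʳ ⟫ (≈m-sym 𝕀⊗𝕀 ⟩⊗⟨refl ⟫ ≋⇒≈m (⊗m-assoc (𝕀 𝕏*) (𝕀 𝕏*) θ𝕏)) ⟩▸⟨refl)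
         ⟫ ▸-assoc˘) ⟩▸⟨refl ⟩
        (𝕀 𝕏* ⊗m cup′) ▸ (𝕀 𝕏* ⊗m (𝕀 𝕏* ⊗m θ𝕏)) ▸ (σ⁻m 𝕏* 𝕏* ⊗m 𝕀 𝕏) ▸ (𝕀 𝕏* ⊗m cap)
      ≈⟨ ((≈m-sym (𝕀⊗-▸ 𝕏*) ⟫ refl⟩⊗⟨ cup′-θ ⟫ 𝕀⊗-▸ 𝕏*) ⟩▸⟨refl) ⟩▸⟨refl ⟩
        (𝕀 𝕏* ⊗m cup) ▸ (𝕀 𝕏* ⊗m σ⁻m 𝕏* 𝕏) ▸ (σ⁻m 𝕏* 𝕏* ⊗m 𝕀 𝕏) ▸ (𝕀 𝕏* ⊗m cap)
      ≈⟨ (▸-assoc ⟫ refl⟩▸⟨ ≈m-sym σ⁻-hexagon) ⟩▸⟨refl ⟩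
        (𝕀 𝕏* ⊗m cup) ▸ σ⁻m 𝕏* 𝕏*𝕏 ▸ (𝕀 𝕏* ⊗m cap)
      ≈⟨ ▸-assoc ⟫ refl⟩▸⟨ ≈m-sym σ⁻m-natural ⟫ ▸-assoc˘ ⟩
        (𝕀 𝕏* ⊗m cup) ▸ (cap ⊗m 𝕀 𝕏*) ▸ σ⁻m 𝕏* []
      ≈⟨ snake₂m X ⟩▸⟨ ≋⇒≈m (≋-trans (un-σ⁻m-[]ʳ 𝕏*) (≋-sym un-𝕀)) ⟫ ▸-identityˡ ⟩
        𝕀 𝕏*
      ∎
      where
        σ-split : 𝕀 𝕏* ⊗m σm 𝕏 𝕏* ≈m σm 𝕏*𝕏 𝕏* ▸ (σ⁻m 𝕏* 𝕏* ⊗m 𝕀 𝕏)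
        σ-split = ≈m-sym ▸-identityʳ ⟫ refl⟩▸⟨ (≈m-sym 𝕀⊗𝕀 ⟫ ≈m-sym (σm-σ⁻m 𝕏* 𝕏*) ⟩⊗⟨refl ⟫ ▸-⊗𝕀 𝕏)
          ⟫ ▸-assoc˘ ⟫ (≈m-sym (≈m-split (hexagon₂-≋ 𝕏* 𝕏 𝕏* refl)) ⟩▸⟨refl)
        σ⁻-hexagon : σ⁻m 𝕏* 𝕏*𝕏 ≈m (𝕀 𝕏* ⊗m σ⁻m 𝕏* 𝕏) ▸ (σ⁻m 𝕏* 𝕏* ⊗m 𝕀 𝕏)
        σ⁻-hexagon = begin
            σ⁻m 𝕏* 𝕏*𝕏
          ≈⟨ ≈m-sym ▸-identityʳ ⟫ refl⟩▸⟨ ≈m-sym hex-inverse ⟫ ▸-assoc˘ ⟩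
            σ⁻m 𝕏* 𝕏*𝕏 ▸ hex ▸ hex⁻¹
          ≈⟨ (refl⟩▸⟨ ≈m-sym (≈m-split (hexagon₁-≋ 𝕏* 𝕏* 𝕏 refl)) ⟫ σ⁻m-σm 𝕏* 𝕏*𝕏) ⟩▸⟨refl ⟫ ▸-identityˡ ⟩
            hex⁻¹
          ∎
          where
            hex = (σm 𝕏* 𝕏* ⊗m 𝕀 𝕏) ▸ (𝕀 𝕏* ⊗m σm 𝕏* 𝕏)
            hex⁻¹ = (𝕀 𝕏* ⊗m σ⁻m 𝕏* 𝕏) ▸ (σ⁻m 𝕏* 𝕏* ⊗m 𝕀 𝕏)
            hex-inverse : hex ▸ hex⁻¹ ≈m 𝕀 (X * ∷ 𝕏*𝕏)
            hex-inverse = ▸-assoc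
              ⟫ refl⟩▸⟨ (▸-assoc˘ ⟫ (≈m-sym (𝕀⊗-▸ 𝕏*) ⟫ refl⟩⊗⟨ σm-σ⁻m 𝕏* 𝕏 ⟫ 𝕀⊗𝕀) ⟩▸⟨refl ⟫ ▸-identityˡ)
              ⟫ ≈m-sym (▸-⊗𝕀 𝕏) ⟫ σm-σ⁻m 𝕏* 𝕏* ⟩⊗⟨refl ⟫ 𝕀⊗𝕀

    yanking : ∀ {Z V} (k : Mor [] (Z ∷ X ∷ [])) (h : Mor (X ∷ Z ∷ []) (V ∷ [])) →
              cup ▸ (((𝕀 𝕏 ⊗m k) ▸ (h ⊗m 𝕀 𝕏)) ⊗m 𝕀 𝕏*) ▸ (𝕀 (V ∷ []) ⊗m cap′)
                ≈m k ▸ (𝕀 (Z ∷ []) ⊗m θ𝕏) ▸ σm (Z ∷ []) 𝕏 ▸ h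
    yanking {Z} {V} k h = begin
        cup ▸ (((𝕀 𝕏 ⊗m k) ▸ (h ⊗m 𝕀 𝕏)) ⊗m 𝕀 𝕏*) ▸ (𝕀 (V ∷ []) ⊗m cap′)
      ≈⟨ (refl⟩▸⟨ (((≈m-sym (≋⇒≈m (σm-absorbs-stateˡ 𝕏 k)) ⟫ refl⟩▸⟨ hex) ⟩▸⟨refl ⟫ ▸-assoc
           ⟫ refl⟩▸⟨ (▸-assoc ⟫ refl⟩▸⟨ ≈m-sym (▸-⊗𝕀 𝕏)) ⟫ ▸-assoc˘) ⟩⊗⟨refl
           ⟫ ▸-⊗𝕀 𝕏* ⟫ ▸-⊗𝕀 𝕏* ⟩▸⟨refl)) ⟩▸⟨refl ⟩
        cup ▸ (((k ⊗m 𝕀 𝕏) ⊗m 𝕀 𝕏*) ▸ ((𝕀 z ⊗m σm 𝕏 𝕏) ⊗m 𝕀 𝕏*) ▸ (((σm z 𝕏 ▸ h) ⊗m 𝕀 𝕏) ⊗m 𝕀 𝕏*))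
          ▸ (𝕀 (V ∷ []) ⊗m cap′)
      ≈⟨ (▸-assoc˘ ⟫ (▸-assoc˘ ⟫ (refl⟩▸⟨ (≋⇒≈m (⊗m-assoc k (𝕀 𝕏) (𝕀 𝕏*)) ⟫ refl⟩⊗⟨ 𝕀⊗𝕀)
           ⟫ ≈m-sym (state-commutes k cup) ⟫ ≋⇒≈m (⊗m-unitʳ k) ⟩▸⟨refl) ⟩▸⟨refl) ⟩▸⟨refl) ⟩▸⟨refl
         ⟫ ▸-assoc ⟫ refl⟩▸⟨ ((≋⇒≈m (⊗m-assoc (σm z 𝕏 ▸ h) (𝕀 𝕏) (𝕀 𝕏*)) ⟫ refl⟩⊗⟨ 𝕀⊗𝕀) ⟩▸⟨refl
           ⟫ serialiseˡ ⟫ ≈m-sym serialiseʳ ⟫ refl⟩▸⟨ ≋⇒≈m (⊗m-unitʳ (σm z 𝕏 ▸ h))) ⟩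
        k ▸ (𝕀 (Z ∷ X ∷ []) ⊗m cup) ▸ ((𝕀 z ⊗m σm 𝕏 𝕏) ⊗m 𝕀 𝕏*) ▸ ((𝕀 (Z ∷ X ∷ []) ⊗m cap′) ▸ (σm z 𝕏 ▸ h))
      ≈⟨ ((refl⟩▸⟨ (≈m-sym 𝕀⊗𝕀 ⟩⊗⟨refl ⟫ ≋⇒≈m (⊗m-assoc (𝕀 z) (𝕀 𝕏) cup)))
           ⟩▸⟨ ≋⇒≈m (⊗m-assoc (𝕀 z) (σm 𝕏 𝕏) (𝕀 𝕏*))) ⟩▸⟨refl
         ⟫ refl⟩▸⟨ ((≈m-sym 𝕀⊗𝕀 ⟩⊗⟨refl ⟫ ≋⇒≈m (⊗m-assoc (𝕀 z) (𝕀 𝕏) cap′)) ⟩▸⟨refl) ⟩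
        k ▸ (𝕀 z ⊗m (𝕀 𝕏 ⊗m cup)) ▸ (𝕀 z ⊗m (σm 𝕏 𝕏 ⊗m 𝕀 𝕏*)) ▸ ((𝕀 z ⊗m (𝕀 𝕏 ⊗m cap′)) ▸ (σm z 𝕏 ▸ h))
      ≈⟨ ▸-assoc˘ ⟫ (▸-assoc ⟩▸⟨refl ⟫ ▸-assoc
           ⟫ refl⟩▸⟨ (≈m-sym (𝕀⊗-▸ z) ⟩▸⟨refl ⟫ ≈m-sym (𝕀⊗-▸ z) ⟫ refl⟩⊗⟨ curl≈θ)) ⟩▸⟨refl ⟫ ▸-assoc˘ ⟩
        k ▸ (𝕀 z ⊗m θ𝕏) ▸ σm z 𝕏 ▸ h
      ∎
      where
        z = Z ∷ []
        hex : σm (Z ∷ X ∷ []) 𝕏 ≈m (𝕀 z ⊗m σm 𝕏 𝕏) ▸ (σm z 𝕏 ⊗m 𝕀 𝕏)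
        hex = ≈m-split (hexagon₂-≋ z 𝕏 𝕏 refl)

  swapθ : ∀ {Z Y} → Mor [] (Z ∷ Y ∷ []) → Mor [] (Y ∷ Z ∷ [])
  swapθ {Z} {Y} N = N ▸ σm (Z ∷ []) (Y ∷ []) ▸ (θm (Y ∷ []) ⊗m 𝕀 (Z ∷ []))

  swapθ-nested : ∀ {Z Y Z′ Y′} (N : Mor [] (Z ∷ Y ∷ [])) (N′ : Mor [] (Z′ ∷ Y′ ∷ [])) →
        (N ▸ (𝕀 (Z ∷ []) ⊗m (N′ ⊗m 𝕀 (Y ∷ [])))) ▸ σm (Z ∷ Z′ ∷ []) (Y′ ∷ Y ∷ []) ▸
          (θm (Y′ ∷ Y ∷ []) ⊗m 𝕀 (Z ∷ Z′ ∷ []))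
          ≈m swapθ N′ ▸ (𝕀 (Y′ ∷ []) ⊗m (swapθ N ⊗m 𝕀 (Z′ ∷ [])))
  swapθ-nested {Z} {Y} {Z′} {Y′} N N′ = begin
      (N ▸ (𝕀 z ⊗m (N′ ⊗m 𝕀 y))) ▸ σm zz yy ▸ (θm yy ⊗m 𝕀 zz)
    ≈⟨ expand ⟩
      N ▸ (𝕀 z ⊗m ((s′ ⊗m 𝕀 y) ▸ (𝕀 y′ ⊗m σm z′ y))) ▸ (σm z yy ⊗m 𝕀 z′) ▸ ((σm y′ y ▸ θθσ) ⊗m 𝕀 zz)
    ≈⟨ ▸-assoc ⟫ refl⟩▸⟨ pull-σy′y ⟫ ▸-assoc˘
       ⟫ (▸-assoc ⟫ refl⟩▸⟨ (≈m-sym (𝕀⊗-▸ z) ⟫ refl⟩⊗⟨ N′-crosses-y)) ⟩▸⟨refl ⟫ ▸-assoc˘ ⟩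
      N ▸ (𝕀 z ⊗m (𝕀 y ⊗m s′)) ▸ (σm z yy′ ⊗m 𝕀 z′) ▸ (θθσ ⊗m 𝕀 zz)
    ≈⟨ regroup ⟩
      swapθ N′ ▸ (𝕀 y′ ⊗m (swapθ N ⊗m 𝕀 z′))
    ∎
    where
      z = Z ∷ []
      y = Y ∷ []
      z′ = Z′ ∷ []
      y′ = Y′ ∷ []
      zz = Z ∷ Z′ ∷ []
      yy = Y′ ∷ Y ∷ []
      yy′ = Y ∷ Y′ ∷ []
      s′ = N′ ▸ σm z′ y′
      θθσ = (θm y ⊗m θm y′) ▸ σm y y′
      YZ = Y ∷ Z ∷ []
      swapθN = swapθ N
      swapθN′ = swapθ N′
      hex-zz : σm zz yy ≈m (𝕀 z ⊗m σm z′ yy) ▸ (σm z yy ⊗m 𝕀 z′)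
      hex-zz = ≈m-split (hexagon₂-≋ z z′ yy refl)
      hex-z′ : σm z′ yy ≈m (σm z′ y′ ⊗m 𝕀 y) ▸ (𝕀 y′ ⊗m σm z′ y)
      hex-z′ = ≈m-split (hexagon₁-≋ z′ y′ y refl)
      hex-y′z′ : σm (Y′ ∷ Z′ ∷ []) y ≈m (𝕀 y′ ⊗m σm z′ y) ▸ (σm y′ y ⊗m 𝕀 z′)
      hex-y′z′ = ≈m-split (hexagon₂-≋ y′ z′ y refl)
      hex-z : σm z yy′ ≈m (σm z y ⊗m 𝕀 y′) ▸ (𝕀 y ⊗m σm z y′)
      hex-z = ≈m-split (hexagon₁-≋ z y y′ refl)
      hex-yz : σm YZ y′ ≈m (𝕀 y ⊗m σm z y′) ▸ (σm y y′ ⊗m 𝕀 z)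
      hex-yz = ≈m-split (hexagon₂-≋ y z y′ refl)
      σzy-first : (𝕀 z ⊗m (𝕀 y ⊗m s′)) ▸ ((σm z y ⊗m 𝕀 y′) ⊗m 𝕀 z′) ≈m σm z y ▸ (𝕀 YZ ⊗m s′)
      σzy-first = (≈m-sym (≋⇒≈m (⊗m-assoc (𝕀 z) (𝕀 y) s′))
        ⟫ 𝕀⊗𝕀 ⟩⊗⟨refl) ⟩▸⟨ (≋⇒≈m (⊗m-assoc (σm z y) (𝕀 y′) (𝕀 z′)) ⟫ refl⟩⊗⟨ 𝕀⊗𝕀) ⟫ serialiseʳ
        ⟫ ≈m-sym serialiseˡ ⟫ (≋⇒≈m (⊗m-unitʳ (σm z y)) ⟩▸⟨refl)
      split-σz : N ▸ (𝕀 z ⊗m (𝕀 y ⊗m s′)) ▸ (σm z yy′ ⊗m 𝕀 z′)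
        ≈m N ▸ σm z y ▸ (𝕀 YZ ⊗m s′) ▸ ((𝕀 y ⊗m σm z y′) ⊗m 𝕀 z′)
      split-σz = refl⟩▸⟨ (hex-z ⟩⊗⟨refl ⟫ ▸-⊗𝕀 z′) ⟫ ▸-assoc˘
        ⟫ ((▸-assoc ⟫ refl⟩▸⟨ σzy-first ⟫ ▸-assoc˘) ⟩▸⟨refl)
      θy′-past-σ : (σm z y′ ⊗m 𝕀 z′) ▸ (θm y′ ⊗m 𝕀 zz) ≈m ((𝕀 z ⊗m θm y′) ⊗m 𝕀 z′) ▸ (σm z y′ ⊗m 𝕀 z′)
      θy′-past-σ = refl⟩▸⟨ (refl⟩⊗⟨ ≈m-sym 𝕀⊗𝕀 ⟫ ≈m-sym (≋⇒≈m (⊗m-assoc (θm y′) (𝕀 z) (𝕀 z′))))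
        ⟫ ≈m-sym (▸-⊗𝕀 z′) ⟫ ≈m-sym σm-natural ⟩⊗⟨refl ⟫ ▸-⊗𝕀 z′
      slide-θy′ : ((𝕀 y ⊗m σm z y′) ⊗m 𝕀 z′) ▸ ((θm y ⊗m θm y′) ⊗m 𝕀 zz)
        ≈m (θm y ⊗m (𝕀 z ⊗m (θm y′ ⊗m 𝕀 z′))) ▸ ((𝕀 y ⊗m σm z y′) ⊗m 𝕀 z′)
      slide-θy′ = ≋⇒≈m (⊗m-assoc (𝕀 y) (σm z y′) (𝕀 z′)) ⟩▸⟨ ≋⇒≈m (⊗m-assoc (θm y) (θm y′) (𝕀 zz))
        ⟫ ≈m-sym interchange ⟫ (▸-identityˡ ⟫ ≈m-sym ▸-identityʳ) ⟩⊗⟨ θy′-past-σ ⟫ interchange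
        ⟫ ((refl⟩⊗⟨ ≋⇒≈m (⊗m-assoc (𝕀 z) (θm y′) (𝕀 z′))) ⟩▸⟨ ≈m-sym (≋⇒≈m (⊗m-assoc (𝕀 y) (σm z y′) (𝕀 z′))))
      collect-swapθN′ : (𝕀 YZ ⊗m s′) ▸ (θm y ⊗m (𝕀 z ⊗m (θm y′ ⊗m 𝕀 z′))) ≈m (θm y ⊗m 𝕀 z) ▸ (𝕀 YZ ⊗m swapθN′)
      collect-swapθN′ = refl⟩▸⟨ ≈m-sym (≋⇒≈m (⊗m-assoc (θm y) (𝕀 z) (θm y′ ⊗m 𝕀 z′))) ⟫ ≈m-sym interchange
        ⟫ (▸-identityˡ ⟫ ≈m-sym ▸-identityʳ) ⟩⊗⟨ ≈m-sym ▸-identityˡ ⟫ interchange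
        ⟫ (≋⇒≈m (⊗m-unitʳ (θm y ⊗m 𝕀 z)) ⟩▸⟨refl)
      merge-σ : ((𝕀 y ⊗m σm z y′) ⊗m 𝕀 z′) ▸ (σm y y′ ⊗m 𝕀 zz) ≈m σm YZ y′ ⊗m 𝕀 z′
      merge-σ = refl⟩▸⟨ (refl⟩⊗⟨ ≈m-sym 𝕀⊗𝕀 ⟫ ≈m-sym (≋⇒≈m (⊗m-assoc (σm y y′) (𝕀 z) (𝕀 z′))))
        ⟫ ≈m-sym (▸-⊗𝕀 z′) ⟫ (≈m-sym hex-yz ⟩⊗⟨refl)
      exchange-states : swapθN ▸ (𝕀 YZ ⊗m swapθN′) ▸ (σm YZ y′ ⊗m 𝕀 z′)
        ≈m swapθN′ ▸ (𝕀 y′ ⊗m (swapθN ⊗m 𝕀 z′))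
      exchange-states = (≈m-sym (≋⇒≈m (⊗m-unitʳ swapθN)) ⟩▸⟨refl ⟫ serialiseˡ ⟫ ≈m-sym serialiseʳ
        ⟫ ⊗m-unitˡ swapθN′ ⟩▸⟨refl) ⟩▸⟨refl ⟫ ▸-assoc
        ⟫ (refl⟩▸⟨ ((refl⟩⊗⟨ ≈m-sym 𝕀⊗𝕀 ⟫ ≈m-sym (≋⇒≈m (⊗m-assoc swapθN (𝕀 y′) (𝕀 z′)))) ⟩▸⟨refl
        ⟫ ≈m-sym (▸-⊗𝕀 z′) ⟫ ≋⇒≈m (σm-absorbs-stateˡ y′ swapθN) ⟩⊗⟨refl
        ⟫ ≋⇒≈m (⊗m-assoc (𝕀 y′) swapθN (𝕀 z′))))
      expand : (N ▸ (𝕀 z ⊗m (N′ ⊗m 𝕀 y))) ▸ σm zz yy ▸ (θm yy ⊗m 𝕀 zz)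
        ≈m N ▸ (𝕀 z ⊗m ((s′ ⊗m 𝕀 y) ▸ (𝕀 y′ ⊗m σm z′ y))) ▸ (σm z yy ⊗m 𝕀 z′) ▸ ((σm y′ y ▸ θθσ) ⊗m 𝕀 zz)
      expand = ((refl⟩▸⟨ hex-zz ⟫ ▸-assoc˘
        ⟫ (▸-assoc ⟫ refl⟩▸⟨ (≈m-sym (𝕀⊗-▸ z)
        ⟫ refl⟩⊗⟨ (refl⟩▸⟨ hex-z′ ⟫ ▸-assoc˘ ⟫ ≈m-sym (▸-⊗𝕀 y) ⟩▸⟨refl))) ⟩▸⟨refl) ⟩▸⟨ ((θm-++ y′ y
        ⟫ ▸-assoc) ⟩⊗⟨refl))
      pull-σy′y : (σm z yy ⊗m 𝕀 z′) ▸ ((σm y′ y ▸ θθσ) ⊗m 𝕀 zz)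
        ≈m (𝕀 z ⊗m (σm y′ y ⊗m 𝕀 z′)) ▸ ((σm z yy′ ⊗m 𝕀 z′) ▸ (θθσ ⊗m 𝕀 zz))
      pull-σy′y = refl⟩▸⟨ ▸-⊗𝕀 zz ⟫ ▸-assoc˘
        ⟫ (refl⟩▸⟨ (refl⟩⊗⟨ ≈m-sym 𝕀⊗𝕀 ⟫ ≈m-sym (≋⇒≈m (⊗m-assoc (σm y′ y) (𝕀 z) (𝕀 z′)))) ⟫ ≈m-sym (▸-⊗𝕀 z′)
        ⟫ ≈m-sym σm-natural ⟩⊗⟨refl ⟫ ▸-⊗𝕀 z′ ⟫ ≋⇒≈m (⊗m-assoc (𝕀 z) (σm y′ y) (𝕀 z′)) ⟩▸⟨refl) ⟩▸⟨refl
        ⟫ ▸-assoc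
      N′-crosses-y : ((s′ ⊗m 𝕀 y) ▸ (𝕀 y′ ⊗m σm z′ y)) ▸ (σm y′ y ⊗m 𝕀 z′) ≈m 𝕀 y ⊗m s′
      N′-crosses-y = ▸-assoc ⟫ refl⟩▸⟨ ≈m-sym hex-y′z′ ⟫ ≋⇒≈m (σm-absorbs-stateˡ y s′)
      regroup : N ▸ (𝕀 z ⊗m (𝕀 y ⊗m s′)) ▸ (σm z yy′ ⊗m 𝕀 z′) ▸ (θθσ ⊗m 𝕀 zz)
        ≈m swapθ N′ ▸ (𝕀 y′ ⊗m (swapθ N ⊗m 𝕀 z′))
      regroup = split-σz ⟩▸⟨refl ⟫ refl⟩▸⟨ ▸-⊗𝕀 zz ⟫ ▸-assoc˘
        ⟫ (▸-assoc ⟫ refl⟩▸⟨ slide-θy′ ⟫ ▸-assoc˘) ⟩▸⟨refl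
        ⟫ ((▸-assoc ⟫ refl⟩▸⟨ collect-swapθN′ ⟫ ▸-assoc˘) ⟩▸⟨refl) ⟩▸⟨refl ⟫ ▸-assoc ⟫ refl⟩▸⟨ merge-σ
        ⟫ exchange-states

  snake-nested : ∀ {Z Y Z′ Y′} (P : Mor [] (Y ∷ Z ∷ [])) (E : Mor (Z ∷ Y ∷ []) [])
    (P′ : Mor [] (Y′ ∷ Z′ ∷ [])) (E′ : Mor (Z′ ∷ Y′ ∷ []) []) →
        (P ⊗m 𝕀 (Y ∷ [])) ▸ (𝕀 (Y ∷ []) ⊗m E) ≈m 𝕀 (Y ∷ []) →
        (P′ ⊗m 𝕀 (Y′ ∷ [])) ▸ (𝕀 (Y′ ∷ []) ⊗m E′) ≈m 𝕀 (Y′ ∷ []) →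
        ((P′ ▸ (𝕀 (Y′ ∷ []) ⊗m (P ⊗m 𝕀 (Z′ ∷ [])))) ⊗m 𝕀 (Y′ ∷ Y ∷ [])) ▸
          (𝕀 (Y′ ∷ Y ∷ []) ⊗m ((𝕀 (Z ∷ []) ⊗m (E′ ⊗m 𝕀 (Y ∷ []))) ▸ E)) ≈m 𝕀 (Y′ ∷ Y ∷ [])
  snake-nested {Z} {Y} {Z′} {Y′} P E P′ E′ S S′ = begin
      ((P′ ▸ P-inside) ⊗m 𝕀 yy) ▸ (𝕀 yy ⊗m (E′-inside ▸ E))
    ≈⟨ ▸-⊗𝕀 yy ⟩▸⟨ 𝕀⊗-▸ yy ⟩
      ((P′ ⊗m 𝕀 yy) ▸ (P-inside ⊗m 𝕀 yy)) ▸ ((𝕀 yy ⊗m E′-inside) ▸ (𝕀 yy ⊗m E))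
    ≈⟨ ▸-assoc ⟫ refl⟩▸⟨ (▸-assoc˘ ⟫ exchange ⟩▸⟨refl ⟫ ▸-assoc) ⟫ ▸-assoc˘ ⟩
      ((P′ ⊗m 𝕀 yy) ▸ (𝕀 y′ ⊗m (E′ ⊗m 𝕀 y))) ▸ ((𝕀 y′ ⊗m (P ⊗m 𝕀 y)) ▸ (𝕀 yy ⊗m E))
    ≈⟨ snake-P′E′ ⟩▸⟨ snake-PE ⟫ ▸-identityˡ ⟩
      𝕀 yy
    ∎
    where
      z = Z ∷ []
      y = Y ∷ []
      z′ = Z′ ∷ []
      y′ = Y′ ∷ []
      yy = Y′ ∷ Y ∷ []
      P-inside = 𝕀 y′ ⊗m (P ⊗m 𝕀 z′)
      E′-inside = 𝕀 z ⊗m (E′ ⊗m 𝕀 y)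
      exchange : (P-inside ⊗m 𝕀 yy) ▸ (𝕀 yy ⊗m E′-inside) ≈m (𝕀 y′ ⊗m (E′ ⊗m 𝕀 y)) ▸ (𝕀 y′ ⊗m (P ⊗m 𝕀 y))
      exchange = (≋⇒≈m (⊗m-assoc (𝕀 y′) (P ⊗m 𝕀 z′) (𝕀 yy))
        ⟫ refl⟩⊗⟨ (≋⇒≈m (⊗m-assoc P (𝕀 z′) (𝕀 yy)) ⟫ refl⟩⊗⟨ 𝕀⊗𝕀)) ⟩▸⟨ (≈m-sym 𝕀⊗𝕀 ⟩⊗⟨refl
        ⟫ ≋⇒≈m (⊗m-assoc (𝕀 y′) (𝕀 y) E′-inside)
        ⟫ refl⟩⊗⟨ (≈m-sym (≋⇒≈m (⊗m-assoc (𝕀 y) (𝕀 z) (E′ ⊗m 𝕀 y))) ⟫ 𝕀⊗𝕀 ⟩⊗⟨refl))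
        ⟫ ≈m-sym (𝕀⊗-▸ y′) ⟫ refl⟩⊗⟨ (serialiseˡ ⟫ ≈m-sym serialiseʳ ⟫ ⊗m-unitˡ (E′ ⊗m 𝕀 y) ⟩▸⟨refl)
        ⟫ 𝕀⊗-▸ y′
      snake-P′E′ : (P′ ⊗m 𝕀 yy) ▸ (𝕀 y′ ⊗m (E′ ⊗m 𝕀 y)) ≈m 𝕀 yy
      snake-P′E′ = (refl⟩⊗⟨ ≈m-sym 𝕀⊗𝕀 ⟫ ≈m-sym (≋⇒≈m (⊗m-assoc P′ (𝕀 y′) (𝕀 y)))) ⟩▸⟨ ≈m-sym
        (≋⇒≈m (⊗m-assoc (𝕀 y′) E′ (𝕀 y))) ⟫ ≈m-sym (▸-⊗𝕀 y) ⟫ S′ ⟩⊗⟨refl ⟫ 𝕀⊗𝕀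
      snake-PE : (𝕀 y′ ⊗m (P ⊗m 𝕀 y)) ▸ (𝕀 yy ⊗m E) ≈m 𝕀 yy
      snake-PE = refl⟩▸⟨ (≈m-sym 𝕀⊗𝕀 ⟩⊗⟨refl ⟫ ≋⇒≈m (⊗m-assoc (𝕀 y′) (𝕀 y) E)) ⟫ ≈m-sym (𝕀⊗-▸ y′) ⟫ refl⟩⊗⟨ S
        ⟫ 𝕀⊗𝕀

module ReflexiveCalculus {o ℓ e} {C : Category o ℓ e} {M : StrictMonoidal C} {R : Ribbon M}
                         (Rf : Reflexive R) where
  open Category C
  open StrictMonoidal M
  open Ribbon R
  open Reflexive Rf
  open Combinators Rf
  open RibbonCalculus R

  module _ {X : Obj} where
    open Cups X

    -- Straightening the loop of the trace leaves one twist.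
    trace-yanking : ∀ {Z V} (k : Mor [] (Z ∷ X ∷ [])) (h : Mor (X ∷ Z ∷ []) (V ∷ []))
                      (f : Hom (𝟙 ⊗₀ X) (V ⊗₀ X)) →
                    f ≋ un ((𝕀 𝕏 ⊗m k) ▸ (h ⊗m 𝕀 𝕏)) →
                    trace X 𝟙 V f ≋ un (k ▸ (𝕀 (Z ∷ []) ⊗m θ𝕏) ▸ σm (Z ∷ []) 𝕏 ▸ h)
    trace-yanking {Z} {V} k h f f≋ = ≋-trans trace≋ (≈⇒≋ (pf (yanking k h)))
      where
        g = (𝕀 𝕏 ⊗m k) ▸ (h ⊗m 𝕀 𝕏)
        trace≋ : trace X 𝟙 V f ≋ un (cup ▸ (g ⊗m 𝕀 𝕏*) ▸ (𝕀 (V ∷ []) ⊗m cap′))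
        trace≋ = ≋-trans
          (coe-elimʳ unitʳ₀ (coe-elimᵐ ⊗-assoc₀
          (coe-elimᵐ (sym ⊗-assoc₀) (coe-elimˡ (sym unitʳ₀) ⊗-unitˡ≋)
          (≋-sym (≋-trans (un-⊗m g (𝕀 _)) (⊗-resp-≋ (≋-sym f≋) un-𝕀))))
          (≋-sym (≋-trans (un-⊗m _ _) (⊗-resp-≋ un-𝕀 un-cap′)))))
          (≋-sym (≋-trans (un-▸ _ _) (⨾-resp-≋ (un-▸ _ _) ≋-refl)))

  open Cups A using (cup; cap; cup′; cap′; un-cup′; un-cap′; snake′; cup-twist; cup′-untwist;
    θ⁻-slides-along-cup)
    renaming (𝕏 to 𝔸; 𝕏* to 𝔸*; 𝕏𝕏* to 𝔸𝔸*; 𝕏*𝕏 to 𝔸*𝔸; θ𝕏 to θ𝔸)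

  φm : Mor 𝔸𝔸* 𝔸
  φm = ⌜ φ ⌝

  φ⁻m : Mor 𝔸 𝔸𝔸*
  φ⁻m = ⌜ φ⁻¹ ⌝

  φm-φ⁻m : φm ▸ φ⁻m ≈m 𝕀 𝔸𝔸*
  φm-φ⁻m = ≋⇒≈m (≋-trans (un-▸ φm φ⁻m) (≋-trans (≈⇒≋ φ-φ⁻¹) (≋-sym un-𝕀)))

  φ⁻m-φm : φ⁻m ▸ φm ≈m 𝕀 𝔸
  φ⁻m-φm = ≋⇒≈m (≋-trans (un-▸ φ⁻m φm) (≋-trans (≈⇒≋ φ⁻¹-φ) (≋-sym un-𝕀)))

  lamᵐ : Mor 𝔸 (A ∷ A ∷ [])
  lamᵐ = (𝕀 𝔸 ⊗m cup′) ▸ (φm ⊗m 𝕀 𝔸)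
  appᵐ : Mor (A ∷ A ∷ []) 𝔸
  appᵐ = (φ⁻m ⊗m 𝕀 𝔸) ▸ (𝕀 𝔸 ⊗m cap)

  lam≋lamᵐ : lam ≋ un lamᵐ
  lam≋lamᵐ = ≋-trans (coe-elimᵐ (sym ⊗-assoc₀)
    (≋-trans (⨾-resp-≋ (⨾-resp-≋ (coe-elimˡ (sym unitʳ₀) ≋-refl) ≋-refl) ≋-refl)
    (≋-trans (≈⇒≋ (≈.sym (≈.trans id⊗-⨾ (⨾-resp-≈ id⊗-⨾ ≈.refl))))
    (≋-sym (≋-trans (un-⊗m _ _) (⊗-resp-≋ un-𝕀 un-cup′)))))
    (≋-sym (≋-trans (un-⊗m _ _) (⊗-resp-≋ ≋-refl un-𝕀))))
    (≋-sym (un-▸ _ _))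

  app≋appᵐ : app ≋ un appᵐ
  app≋appᵐ = ≋-trans (coe-elimʳ unitʳ₀
    (coe-elimᵐ ⊗-assoc₀ (≋-sym (≋-trans (un-⊗m _ _) (⊗-resp-≋ ≋-refl un-𝕀)))
    (≋-sym (≋-trans (un-⊗m _ _) (⊗-resp-≋ un-𝕀 ≋-refl))))) (≋-sym (un-▸ _ _))

  -- The β-law of F

  duals : ℕ → Obj
  duals zero = A *
  duals (suc m) = duals m ⊗₀ A *

  cups : ∀ m → Hom 𝟙 (duals m ⊗₀ A^ (suc m))
  cups zero = un cup′ ⨾ (id {A *} ⊗₁ coe (sym unitʳ₀))
  cups (suc m) = cups m ⨾ (id {duals m} ⊗₁ (coe (sym unitˡ₀) ⨾ (un cup′ ⊗₁ id {A^ (suc m)}) ⨾ coe ⊗-assoc₀))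
    ⨾ coe (sym ⊗-assoc₀)

  φs : ∀ m → Hom (A ⊗₀ duals m) A
  φs zero = φ
  φs (suc m) = coe (sym ⊗-assoc₀) ⨾ (φs m ⊗₁ id {A *}) ⨾ φ

  caps : ∀ m → Hom (duals m ⊗₀ A^ (suc m)) 𝟙
  caps zero = (id {A *} ⊗₁ coe unitʳ₀) ⨾ ε A
  caps (suc m) = coe ⊗-assoc₀ ⨾
    (id {duals m} ⊗₁ (coe (sym ⊗-assoc₀) ⨾ (ε A ⊗₁ id {A^ (suc m)}) ⨾ coe unitˡ₀)) ⨾ caps m

  swapped-cups : ∀ m → Hom 𝟙 (A^ (suc m) ⊗₀ duals m)
  swapped-cups m = cups m ⨾ σ (duals m) (A^ (suc m)) ⨾ (θ (A^ (suc m)) ⊗₁ id {duals m})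

  φsᵐ : ∀ m → Mor (A ∷ duals m ∷ []) 𝔸
  φsᵐ m = ⌜ φs m ⌝
  cupsᵐ : ∀ m → Mor [] (duals m ∷ A^ (suc m) ∷ [])
  cupsᵐ m = ⌜ cups m ⌝
  capsᵐ : ∀ m → Mor (duals m ∷ A^ (suc m) ∷ []) []
  capsᵐ m = ⌜ caps m ⌝
  swapped-cupsᵐ : ∀ m → Mor [] (A^ (suc m) ∷ duals m ∷ [])
  swapped-cupsᵐ m = ⌜ swapped-cups m ⌝

  cups-zero : cups zero ≋ un cup′
  cups-zero = ≋id-elimʳ (id⊗coe≋id (sym unitʳ₀))

  caps-zero : caps zero ≋ ε A
  caps-zero = ≋id-elimˡ (id⊗coe≋id unitʳ₀)

  cups-suc : ∀ m → cups (suc m) ≋ un (cupsᵐ m ▸ (𝕀 (duals m ∷ []) ⊗m (cup′ ⊗m 𝕀 (A^ (suc m) ∷ []))))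
  cups-suc m = ≋-trans (coe-elimʳ (sym ⊗-assoc₀)
    (⨾-resp-≋ ≋-refl (≋-sym
    (≋-trans (un-⊗m (𝕀 (duals m ∷ [])) (cup′ ⊗m 𝕀 (A^ (suc m) ∷ [])))
    (⊗-resp-≋ un-𝕀 (≋-trans (un-⊗m cup′ (𝕀 (A^ (suc m) ∷ [])))
    (≋-trans (⊗-resp-≋ ≋-refl un-𝕀) (≋-sym (coe-elimʳ ⊗-assoc₀ (coe-elimˡ (sym unitˡ₀) ≋-refl))))))))))
    (≋-sym (un-▸ (cupsᵐ m) (𝕀 (duals m ∷ []) ⊗m (cup′ ⊗m 𝕀 (A^ (suc m) ∷ [])))))

  φs-sucᵐ : ∀ m → Mor (A ∷ duals m ∷ A * ∷ []) 𝔸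
  φs-sucᵐ m = (φsᵐ m ⊗m 𝕀 𝔸*) ▸ φm

  φs-suc : ∀ m → φs (suc m) ≋ un (φs-sucᵐ m)
  φs-suc m = ≋-trans (⨾-resp-≋
    (coe-elimˡ (sym ⊗-assoc₀) (≋-sym (≋-trans (un-⊗m (φsᵐ m) (𝕀 𝔸*)) (⊗-resp-≋ ≋-refl un-𝕀)))) ≋-refl)
    (≋-sym (un-▸ (φsᵐ m ⊗m 𝕀 𝔸*) φm))

  caps-suc : ∀ m → caps (suc m) ≋ un ((𝕀 (duals m ∷ []) ⊗m (cap ⊗m 𝕀 (A^ (suc m) ∷ []))) ▸ capsᵐ m)
  caps-suc m = ≋-trans (⨾-resp-≋
    (coe-elimˡ ⊗-assoc₀ (≋-sym
    (≋-trans (un-⊗m (𝕀 (duals m ∷ [])) (cap ⊗m 𝕀 (A^ (suc m) ∷ [])))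
    (⊗-resp-≋ un-𝕀 (≋-trans (un-⊗m cap (𝕀 (A^ (suc m) ∷ [])))
    (≋-trans (⊗-resp-≋ ≋-refl un-𝕀) (≋-sym (coe-elimʳ unitˡ₀ (coe-elimˡ (sym ⊗-assoc₀) ≋-refl))))))))) ≋-refl)
    (≋-sym (un-▸ (𝕀 (duals m ∷ []) ⊗m (cap ⊗m 𝕀 (A^ (suc m) ∷ []))) (capsᵐ m)))

  lamₘ-via-cups : ∀ m → lamₘ (suc m) ≋ un ((𝕀 𝔸 ⊗m cupsᵐ m) ▸ (φsᵐ m ⊗m 𝕀 (A^ (suc m) ∷ [])))
  lamₘ-via-cups zero = ≋-trans (coe-elimʳ ⊗-assoc₀ (coe-elimˡ (sym unitʳ₀) ⊗-unitʳ≋))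
    (≋-trans lam≋lamᵐ (≋-trans (un-▸ _ _)
    (≋-sym (≋-trans (un-▸ _ _)
    (⨾-resp-≋ (≋-trans (un-⊗m (𝕀 𝔸) (cupsᵐ zero))
    (≋-sym (≋-trans (un-⊗m (𝕀 𝔸) cup′) (⊗-resp-≋ ≋-refl (≋-sym cups-zero)))))
    (≋-trans (un-⊗m (φsᵐ zero) (𝕀 (A^ 1 ∷ [])))
    (≋-sym (≋-trans (un-⊗m φm (𝕀 𝔸))
    (⊗-resp-≋ ≋-refl (≋-trans un-𝕀
    (≋-trans (id≋id (sym unitʳ₀)) (≋-sym un-𝕀))))))))))))
  lamₘ-via-cups (suc m) = ≋-trans
    (coe-elimʳ ⊗-assoc₀ (⨾-resp-≋ (lamₘ-via-cups m)
    (≋-sym (≋-trans (un-⊗m lamᵐ (𝕀 ys)) (⊗-resp-≋ (≋-sym lam≋lamᵐ) un-𝕀)))))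
    (≋-trans (≋-sym (un-▸ ((𝕀 𝔸 ⊗m cupsᵐ m) ▸ (φsᵐ m ⊗m 𝕀 ys)) (lamᵐ ⊗m 𝕀 ys)))
    (≋-trans (≈⇒≋ (pf regroup))
    (≋-trans (un-▸ _ _) (≋-trans (⨾-resp-≋ lift-cups-suc lift-φs-suc) (≋-sym (un-▸ _ _))))))
    where
      ys = A^ (suc m) ∷ []
      zw = duals m ∷ []
      φs-lam : (φsᵐ m) ▸ lamᵐ ≈m (𝕀 (A ∷ zw) ⊗m cup′) ▸ (φs-sucᵐ m ⊗m 𝕀 𝔸)
      φs-lam = ▸-assoc˘ ⟫ (≈m-sym (≋⇒≈m (⊗m-unitʳ (φsᵐ m))) ⟩▸⟨refl ⟫ serialiseˡ ⟫ ≈m-sym serialiseʳ) ⟩▸⟨refl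
        ⟫ ▸-assoc ⟫ (refl⟩▸⟨ ((refl⟩⊗⟨ ≈m-sym 𝕀⊗𝕀 ⟫ ≈m-sym (≋⇒≈m (⊗m-assoc (φsᵐ m) (𝕀 𝔸*) (𝕀 𝔸)))) ⟩▸⟨refl
        ⟫ ≈m-sym (▸-⊗𝕀 𝔸)))
      cups-part : (𝕀 𝔸 ⊗m cupsᵐ m) ▸ ((𝕀 (A ∷ zw) ⊗m cup′) ⊗m 𝕀 ys)
        ≈m 𝕀 𝔸 ⊗m (cupsᵐ m ▸ (𝕀 zw ⊗m (cup′ ⊗m 𝕀 ys)))
      cups-part = refl⟩▸⟨ (≋⇒≈m (⊗m-assoc (𝕀 (A ∷ zw)) cup′ (𝕀 ys)) ⟫ ≈m-sym 𝕀⊗𝕀 ⟩⊗⟨refl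
        ⟫ ≋⇒≈m (⊗m-assoc (𝕀 𝔸) (𝕀 zw) (cup′ ⊗m 𝕀 ys))) ⟫ ≈m-sym (𝕀⊗-▸ 𝔸)
      φs-part : (φs-sucᵐ m ⊗m 𝕀 𝔸) ⊗m 𝕀 ys ≈m φs-sucᵐ m ⊗m 𝕀 (A ∷ ys)
      φs-part = ≋⇒≈m (⊗m-assoc (φs-sucᵐ m) (𝕀 𝔸) (𝕀 ys)) ⟫ (refl⟩⊗⟨ 𝕀⊗𝕀)
      regroup : ((𝕀 𝔸 ⊗m cupsᵐ m) ▸ (φsᵐ m ⊗m 𝕀 ys)) ▸ (lamᵐ ⊗m 𝕀 ys)
        ≈m (𝕀 𝔸 ⊗m (cupsᵐ m ▸ (𝕀 zw ⊗m (cup′ ⊗m 𝕀 ys)))) ▸ (φs-sucᵐ m ⊗m 𝕀 (A ∷ ys))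
      regroup = ▸-assoc ⟫ refl⟩▸⟨ ≈m-sym (▸-⊗𝕀 ys) ⟫ refl⟩▸⟨ (φs-lam ⟩⊗⟨refl) ⟫ refl⟩▸⟨ ▸-⊗𝕀 ys ⟫ ▸-assoc˘
        ⟫ (cups-part ⟩▸⟨ φs-part)
      lift-cups-suc : un (𝕀 𝔸 ⊗m (cupsᵐ m ▸ (𝕀 zw ⊗m (cup′ ⊗m 𝕀 ys)))) ≋ un (𝕀 𝔸 ⊗m cupsᵐ (suc m))
      lift-cups-suc = ≋-trans (un-⊗m _ _) (≋-trans (⊗-resp-≋ ≋-refl (≋-sym (cups-suc m))) (≋-sym (un-⊗m _ _)))
      lift-φs-suc : un (φs-sucᵐ m ⊗m 𝕀 (A ∷ ys)) ≋ un (φsᵐ (suc m) ⊗m 𝕀 (A^ (suc (suc m)) ∷ []))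
      lift-φs-suc = ≋-trans (un-⊗m _ _)
        (≋-trans (⊗-resp-≋ (≋-sym (φs-suc m)) (≋-trans un-𝕀 (≋-sym un-𝕀))) (≋-sym (un-⊗m _ _)))

  appₙᵐ : ∀ n → Mor (A ∷ A^ n ∷ []) 𝔸
  appₙᵐ n = ⌜ appₙ n ⌝

  appₙ-one : un (appₙᵐ 1) ≋ un appᵐ
  appₙ-one = coe-elimʳ unitʳ₀ (coe-elimˡ (sym ⊗-assoc₀) (≋-trans ⊗-unitʳ≋ app≋appᵐ))

  appₙ-suc : ∀ m → un (appₙᵐ (suc (suc m))) ≋ un ((appᵐ ⊗m 𝕀 (A^ (suc m) ∷ [])) ▸ appₙᵐ (suc m))
  appₙ-suc m = ≋-trans (⨾-resp-≋
    (coe-elimˡ (sym ⊗-assoc₀)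
    (≋-sym (≋-trans (un-⊗m appᵐ (𝕀 (A^ (suc m) ∷ []))) (⊗-resp-≋ (≋-sym app≋appᵐ) un-𝕀)))) ≋-refl)
    (≋-sym (un-▸ _ _))

  φ-app : (φm ⊗m 𝕀 𝔸) ▸ appᵐ ≈m 𝕀 𝔸 ⊗m cap
  φ-app = ▸-assoc˘ ⟫ (≈m-sym (▸-⊗𝕀 𝔸) ⟫ φm-φ⁻m ⟩⊗⟨refl ⟫ 𝕀⊗𝕀) ⟩▸⟨refl ⟫ ▸-identityˡ

  φs-appₙ : ∀ m → (φsᵐ m ⊗m 𝕀 (A^ (suc m) ∷ [])) ▸ appₙᵐ (suc m) ≈m 𝕀 𝔸 ⊗m capsᵐ m
  φs-appₙ zero = ≋⇒≈m (≋-trans (un-▸ _ _)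
    (≋-trans (⨾-resp-≋ (≋-trans (un-⊗m (φsᵐ zero) (𝕀 _))
    (≋-trans (⊗-resp-≋ ≋-refl (≋-trans un-𝕀 (≋-trans (id≋id unitʳ₀) (≋-sym un-𝕀))))
    (≋-sym (un-⊗m φm (𝕀 𝔸))))) appₙ-one)
    (≋-trans (≋-sym (un-▸ _ _))
    (≋-trans (≈⇒≋ (pf φ-app))
    (≋-trans (un-⊗m (𝕀 𝔸) cap)
    (≋-sym (≋-trans (un-⊗m (𝕀 𝔸) (capsᵐ zero)) (⊗-resp-≋ ≋-refl caps-zero))))))))
  φs-appₙ (suc m) = ≋⇒≈m
    (≋-trans (un-▸ _ _) (≋-trans (⨾-resp-≋ lift-φs-suc (appₙ-suc m))
    (≋-trans (≋-sym (un-▸ _ _)) (≋-trans (≈⇒≋ (pf regroup))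
    (≋-trans (un-⊗m (𝕀 𝔸) _)
    (≋-trans (⊗-resp-≋ ≋-refl (≋-sym (caps-suc m)))
    (≋-sym (un-⊗m (𝕀 𝔸) (capsᵐ (suc m))))))))))
    where
      ys = A^ (suc m) ∷ []
      zw = duals m ∷ []
      lift-φs-suc : un (φsᵐ (suc m) ⊗m 𝕀 (A^ (suc (suc m)) ∷ [])) ≋ un (φs-sucᵐ m ⊗m 𝕀 (A ∷ ys))
      lift-φs-suc = ≋-trans (un-⊗m _ _)
        (≋-trans (⊗-resp-≋ (φs-suc m) (≋-trans un-𝕀 (≋-sym un-𝕀))) (≋-sym (un-⊗m _ _)))
      φs-suc-app : (φs-sucᵐ m ⊗m 𝕀 𝔸) ▸ appᵐ ≈m (𝕀 (A ∷ zw) ⊗m cap) ▸ (φsᵐ m)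
      φs-suc-app = ▸-⊗𝕀 𝔸 ⟩▸⟨refl ⟫ ▸-assoc
        ⟫ refl⟩▸⟨ (▸-assoc˘ ⟫ (≈m-sym (▸-⊗𝕀 𝔸) ⟫ φm-φ⁻m ⟩⊗⟨refl ⟫ 𝕀⊗𝕀) ⟩▸⟨refl ⟫ ▸-identityˡ)
        ⟫ (≋⇒≈m (⊗m-assoc (φsᵐ m) (𝕀 𝔸*) (𝕀 𝔸)) ⟫ refl⟩⊗⟨ 𝕀⊗𝕀) ⟩▸⟨refl ⟫ serialiseˡ ⟫ ≈m-sym serialiseʳ
        ⟫ (refl⟩▸⟨ ≋⇒≈m (⊗m-unitʳ (φsᵐ m)))
      regroup : (φs-sucᵐ m ⊗m 𝕀 (A ∷ ys)) ▸ ((appᵐ ⊗m 𝕀 ys) ▸ appₙᵐ (suc m))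
        ≈m 𝕀 𝔸 ⊗m ((𝕀 zw ⊗m (cap ⊗m 𝕀 ys)) ▸ capsᵐ m)
      regroup = ▸-assoc˘ ⟫ ((refl⟩⊗⟨ ≈m-sym 𝕀⊗𝕀 ⟫ ≈m-sym (≋⇒≈m (⊗m-assoc (φs-sucᵐ m) (𝕀 𝔸) (𝕀 ys)))) ⟩▸⟨refl
        ⟫ ≈m-sym (▸-⊗𝕀 ys) ⟫ φs-suc-app ⟩⊗⟨refl ⟫ ▸-⊗𝕀 ys) ⟩▸⟨refl
        ⟫ ▸-assoc ⟫ refl⟩▸⟨ φs-appₙ m
        ⟫ (≋⇒≈m (⊗m-assoc (𝕀 (A ∷ zw)) cap (𝕀 ys)) ⟫ ≈m-sym 𝕀⊗𝕀 ⟩⊗⟨refl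
        ⟫ ≋⇒≈m (⊗m-assoc (𝕀 𝔸) (𝕀 zw) (cap ⊗m 𝕀 ys))) ⟩▸⟨refl ⟫ ≈m-sym (𝕀⊗-▸ 𝔸)

  swapθ-cups : ∀ m → swapθ (cupsᵐ m) ≈m swapped-cupsᵐ m
  swapθ-cups m = ≋⇒≈m (≋-trans (un-▸ _ _)
    (⨾-resp-≋ (≋-trans (un-▸ _ _) (⨾-resp-≋ ≋-refl (un-σm _ _))) (≋-trans (un-⊗m _ _) (⊗-resp-≋ un-θm un-𝕀))))

  snake-cups : ∀ m → (swapped-cupsᵐ m ⊗m 𝕀 (A^ (suc m) ∷ [])) ▸ (𝕀 (A^ (suc m) ∷ []) ⊗m capsᵐ m)
    ≈m 𝕀 (A^ (suc m) ∷ [])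
  snake-cups zero = ≋⇒≈m
    (≋-trans (un-▸ _ _) (≋-trans
    (⨾-resp-≋ (≋-trans (un-⊗m _ _)
    (≋-trans (⊗-resp-≋ swapped-cups-zero (𝕀≋𝕀 {v = 𝔸} unitʳ₀)) (≋-sym (un-⊗m cup (𝕀 𝔸)))))
    (≋-trans (un-⊗m _ _) (≋-trans
    (⊗-resp-≋ (𝕀≋𝕀 {v = 𝔸} unitʳ₀) caps-zero)
    (≋-sym (un-⊗m (𝕀 𝔸) cap)))))
    (≋-trans (≋-sym (un-▸ _ _)) (≋-trans (≈⇒≋ (pf (snake₁m A))) (𝕀≋𝕀 (sym unitʳ₀))))))
    where
      swapped-cups-zero : swapped-cups zero ≋ un cup
      swapped-cups-zero = ≋-trans
        (⨾-resp-≋ (⨾-resp-≋ cups-zero (≋-trans (σ-cong≋ refl unitʳ₀) (≋-sym (un-σm 𝔸* 𝔸))))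
        (≋-trans (⊗-resp-≋ (θ-cong≋ unitʳ₀) ≋-refl)
        (≋-sym (≋-trans (un-⊗m θ𝔸 (𝕀 𝔸*)) (⊗-resp-≋ un-θm un-𝕀)))))
        (≋-trans (≋-sym (≋-trans (un-▸ _ _) (⨾-resp-≋ (un-▸ _ _) ≋-refl))) (≈⇒≋ (pf cup′-untwist)))
  snake-cups (suc m) = ≋⇒≈m
    (≋-trans (un-▸ _ _) (≋-trans
    (⨾-resp-≋ (≋-trans (un-⊗m _ _) (≋-trans (⊗-resp-≋ swapped-cups-suc (𝕀≋𝕀 refl)) (≋-sym (un-⊗m _ _))))
    (≋-trans (un-⊗m _ _) (≋-trans
    (⊗-resp-≋ (𝕀≋𝕀 refl) (caps-suc m)) (≋-sym (un-⊗m _ _)))))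
    (≋-trans (≋-sym (un-▸ _ _))
    (≋-trans (≈⇒≋ (pf (snake-nested (swapped-cupsᵐ m) (capsᵐ m) cup cap (snake-cups m)
    (snake₁m A)))) (𝕀≋𝕀 refl)))))
    where
      ys = A^ (suc m) ∷ []
      zw = duals m ∷ []
      swapped-cups-suc : swapped-cups (suc m) ≋ un (cup ▸ (𝕀 𝔸 ⊗m (swapped-cupsᵐ m ⊗m 𝕀 𝔸*)))
      swapped-cups-suc = ≋-trans
        (⨾-resp-≋ (⨾-resp-≋ (cups-suc m) (≋-sym (un-σm (duals m ∷ A * ∷ []) (A ∷ ys))))
        (≋-sym (≋-trans (un-⊗m (θm (A ∷ ys)) (𝕀 (duals m ∷ A * ∷ []))) (⊗-resp-≋ un-θm un-𝕀))))
        (≋-trans (≋-sym (≋-trans (un-▸ _ _) (⨾-resp-≋ (un-▸ _ _) ≋-refl)))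
        (≈⇒≋ (pf (swapθ-nested (cupsᵐ m) cup′ ⟫ cup′-untwist ⟩▸⟨ (refl⟩⊗⟨ (swapθ-cups m ⟩⊗⟨refl))))))

  -- F f is the trace of (A ⊗ k) ; (φs ⊗ A) with k = cups ; (duals ⊗ t), t = (A ⊗ f) ; appₙ n.
  -- Yanking the loop twists k; applying app_{m+1} cancels φs against app and the swapped
  -- cups against the caps, leaving t.
  F-β : ∀ {m n} (f : Hom (A^ m) (A^ n)) → ((F {m} {n} f ⊗₁ id {A^ (suc m)}) ⨾ appₙ (suc m))
    ≋ ((id {A} ⊗₁ f) ⨾ appₙ n)
  F-β {m} {n} f = ≋-trans
    (⨾-resp-≋ (≋-trans (⊗-resp-≋ (trace-yanking k (φsᵐ m) _ traced≋) ≋-refl)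
    (≋-sym (≋-trans (un-⊗m _ (𝕀 ys)) (⊗-resp-≋ ≋-refl un-𝕀)))) ≋-refl)
    (≋-trans (≋-sym (un-▸ _ (appₙᵐ (suc m)))) (≈⇒≋ (pf apply-appₙ)))
    where
      ys = A^ (suc m) ∷ []
      zw = duals m ∷ []
      t : Hom (A^ (suc m)) A
      t = (id {A} ⊗₁ f) ⨾ appₙ n
      tᵐ : Mor ys 𝔸
      tᵐ = ⌜ t ⌝
      fᵐ : Mor (A^ m ∷ []) (A^ n ∷ [])
      fᵐ = ⌜ f ⌝
      lamₘᵐ : Mor 𝔸 (A ∷ A^ m ∷ [])
      lamₘᵐ = ⌜ lamₘ m ⌝
      k : Mor [] (duals m ∷ A ∷ [])
      k = (cupsᵐ m) ▸ (𝕀 zw ⊗m tᵐ)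
      separate-f : lamₘᵐ ▸ (lamᵐ ⊗m fᵐ) ▸ (𝕀 𝔸 ⊗m appₙᵐ n)
        ≈m (lamₘᵐ ▸ (lamᵐ ⊗m 𝕀 (A^ m ∷ []))) ▸ (𝕀 𝔸 ⊗m ((𝕀 𝔸 ⊗m fᵐ) ▸ appₙᵐ n))
      separate-f = (refl⟩▸⟨ ≈m-sym serialiseˡ ⟫ ▸-assoc˘) ⟩▸⟨refl ⟫ ▸-assoc
        ⟫ (refl⟩▸⟨ ((≈m-sym 𝕀⊗𝕀 ⟩⊗⟨refl ⟫ ≋⇒≈m (⊗m-assoc (𝕀 𝔸) (𝕀 𝔸) fᵐ)) ⟩▸⟨refl ⟫ ≈m-sym (𝕀⊗-▸ 𝔸)))
      slide-t : (𝕀 𝔸 ⊗m cupsᵐ m) ▸ (φsᵐ m ⊗m 𝕀 ys) ▸ (𝕀 𝔸 ⊗m tᵐ) ≈m (𝕀 𝔸 ⊗m k) ▸ (φsᵐ m ⊗m 𝕀 𝔸)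
      slide-t = ▸-assoc ⟫ refl⟩▸⟨ (serialiseˡ ⟫ ≈m-sym serialiseʳ) ⟫ ▸-assoc˘
        ⟫ ((refl⟩▸⟨ (≈m-sym 𝕀⊗𝕀 ⟩⊗⟨refl ⟫ ≋⇒≈m (⊗m-assoc (𝕀 𝔸) (𝕀 zw) tᵐ)) ⟫ ≈m-sym (𝕀⊗-▸ 𝔸)) ⟩▸⟨refl)
      traced≋ : (coe unitˡ₀ ⨾ lamₘ m ⨾ (lam ⊗₁ f) ⨾ coe ⊗-assoc₀ ⨾ (id ⊗₁ appₙ n))
        ≋ un ((𝕀 𝔸 ⊗m k) ▸ (φsᵐ m ⊗m 𝕀 𝔸))
      traced≋ = ≋-trans (coe-elimᵐ ⊗-assoc₀
        (⨾-resp-≋ (coe-elimˡ unitˡ₀ ≋-refl)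
        (≋-sym (≋-trans (un-⊗m lamᵐ fᵐ) (⊗-resp-≋ (≋-sym lam≋lamᵐ) ≋-refl))))
        (≋-sym (≋-trans (un-⊗m (𝕀 𝔸) (appₙᵐ n)) (⊗-resp-≋ un-𝕀 ≋-refl))))
        (≋-trans (≋-sym (≋-trans (un-▸ _ _) (⨾-resp-≋ (un-▸ _ _) ≋-refl)))
        (≋-trans (≈⇒≋ (pf separate-f))
        (≋-trans (un-▸ _ _)
        (≋-trans (⨾-resp-≋ lamₘ-part appₙ-part)
        (≋-trans (≋-sym (un-▸ _ _)) (≈⇒≋ (pf slide-t)))))))
        where
          lamₘ-part : un (lamₘᵐ ▸ (lamᵐ ⊗m 𝕀 (A^ m ∷ []))) ≋ un ((𝕀 𝔸 ⊗m cupsᵐ m) ▸ (φsᵐ m ⊗m 𝕀 ys))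
          lamₘ-part = ≋-trans (un-▸ _ _)
            (≋-trans (⨾-resp-≋ ≋-refl (≋-trans (un-⊗m lamᵐ (𝕀 _)) (⊗-resp-≋ (≋-sym lam≋lamᵐ) un-𝕀)))
            (≋-trans (≋-sym (coe-elimʳ ⊗-assoc₀ ≋-refl)) (lamₘ-via-cups m)))
          appₙ-part : un (𝕀 𝔸 ⊗m ((𝕀 𝔸 ⊗m fᵐ) ▸ appₙᵐ n)) ≋ un (𝕀 𝔸 ⊗m tᵐ)
          appₙ-part = ≋-trans (un-⊗m _ _)
            (≋-trans (⊗-resp-≋ ≋-refl
            (≋-trans (un-▸ _ _) (⨾-resp-≋ (≋-trans (un-⊗m (𝕀 𝔸) fᵐ) (⊗-resp-≋ un-𝕀 ≋-refl)) ≋-refl)))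
            (≋-sym (un-⊗m (𝕀 𝔸) tᵐ)))
      k-twisted : k ▸ (𝕀 zw ⊗m θ𝔸) ▸ σm zw 𝔸 ≈m swapped-cupsᵐ m ▸ (tᵐ ⊗m 𝕀 zw)
      k-twisted = (▸-assoc ⟫ refl⟩▸⟨ (≈m-sym (𝕀⊗-▸ zw) ⟫ refl⟩⊗⟨ θm-natural ⟫ 𝕀⊗-▸ zw) ⟫ ▸-assoc˘) ⟩▸⟨refl
        ⟫ ▸-assoc ⟫ refl⟩▸⟨ σm-natural ⟫ ▸-assoc˘
        ⟫ ((▸-assoc ⟫ refl⟩▸⟨ σm-natural ⟫ ▸-assoc˘ ⟫ swapθ-cups m) ⟩▸⟨refl)
      apply-appₙ : ((k ▸ (𝕀 zw ⊗m θ𝔸) ▸ σm zw 𝔸 ▸ φsᵐ m) ⊗m 𝕀 ys) ▸ appₙᵐ (suc m) ≈m tᵐ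
      apply-appₙ = ▸-⊗𝕀 ys ⟩▸⟨refl ⟫ ▸-assoc ⟫ refl⟩▸⟨ φs-appₙ m ⟫ (k-twisted ⟩⊗⟨refl ⟫ ▸-⊗𝕀 ys) ⟩▸⟨refl
        ⟫ ▸-assoc
        ⟫ refl⟩▸⟨ ((≋⇒≈m (⊗m-assoc tᵐ (𝕀 zw) (𝕀 ys)) ⟫ refl⟩⊗⟨ 𝕀⊗𝕀) ⟩▸⟨refl ⟫ serialiseˡ
        ⟫ ≈m-sym serialiseʳ ⟫ refl⟩▸⟨ ≋⇒≈m (⊗m-unitʳ tᵐ)) ⟫ ▸-assoc˘ ⟫ snake-cups m ⟩▸⟨refl
        ⟫ ▸-identityˡ

  -- α, β and the cup hidden in them

  double-cup : Mor [] (A ∷ A * ∷ A ∷ A * ∷ [])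
  double-cup = cup ▸ (𝕀 𝔸 ⊗m (cup′ ⊗m 𝕀 𝔸*))
  double-cap : Mor (A ∷ A * ∷ A ∷ A * ∷ []) []
  double-cap = (𝕀 𝔸 ⊗m (cap ⊗m 𝕀 𝔸*)) ▸ cap′

  αᵐ : Mor [] (A ∷ A ∷ [])
  αᵐ = ⌜ α ⌝
  βᵐ : Mor (A ∷ A ∷ []) []
  βᵐ = ⌜ β ⌝

  cup′-lam : Mor [] (A * ∷ A ∷ A ∷ [])
  cup′-lam = cup′ ▸ (𝕀 𝔸* ⊗m lamᵐ)
  -- cup′-lam and φ ⊗ A, retyped with A* ⊗ A as a single letter so that trace-yanking applies.
  α-input : Mor [] (A * ⊗₀ A ∷ A ∷ [])
  α-input = ⌜ un cup′-lam ⨾ coe (sym ⊗-assoc₀) ⌝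
  α-output : Mor (A ∷ A * ⊗₀ A ∷ []) (A ⊗₀ A ∷ [])
  α-output = ⌜ coe (sym ⊗-assoc₀) ⨾ (φ ⊗₁ id {A}) ⌝

  lam-lam-factorises : lamᵐ ▸ (𝕀 𝔸 ⊗m lamᵐ) ≈m (𝕀 𝔸 ⊗m cup′-lam) ▸ (φm ⊗m 𝕀 (A ∷ A ∷ []))
  lam-lam-factorises = ▸-assoc ⟫ refl⟩▸⟨ (serialiseˡ ⟫ ≈m-sym serialiseʳ) ⟫ ▸-assoc˘
    ⟫ ((refl⟩▸⟨ (≈m-sym 𝕀⊗𝕀 ⟩⊗⟨refl ⟫ ≋⇒≈m (⊗m-assoc (𝕀 𝔸) (𝕀 𝔸*) lamᵐ)) ⟫ ≈m-sym (𝕀⊗-▸ 𝔸)) ⟩▸⟨refl)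

  cup′-cup′ : Mor [] (A * ∷ A ∷ A * ∷ A ∷ [])
  cup′-cup′ = cup′ ▸ (𝕀 (A * ∷ A ∷ []) ⊗m cup′)

  yanked-α-planar : cup′-lam ▸ (𝕀 (A * ∷ A ∷ []) ⊗m θ𝔸) ▸ σm (A * ∷ A ∷ []) 𝔸 ▸ (φm ⊗m 𝕀 𝔸)
    ≈m double-cup ▸ (φm ⊗m φm)
  yanked-α-planar = ((cup′-lam-split ⟩▸⟨refl ⟫ ▸-assoc ⟫ refl⟩▸⟨ θ-past-φ ⟫ ▸-assoc˘) ⟩▸⟨refl ⟫ ▸-assoc
    ⟫ refl⟩▸⟨ σm-natural ⟫ ▸-assoc˘) ⟩▸⟨refl ⟫ ▸-assoc ⟫ refl⟩▸⟨ φ⊗φ ⟫ (double-cup-appears ⟩▸⟨refl)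
    where
      cup′-lam-split : cup′-lam ≈m cup′-cup′ ▸ ((𝕀 𝔸* ⊗m φm) ⊗m 𝕀 𝔸)
      cup′-lam-split = refl⟩▸⟨ 𝕀⊗-▸ 𝔸* ⟫ ▸-assoc˘
        ⟫ ((refl⟩▸⟨ (≈m-sym (≋⇒≈m (⊗m-assoc (𝕀 𝔸*) (𝕀 𝔸) cup′)) ⟫ 𝕀⊗𝕀 ⟩⊗⟨refl)) ⟩▸⟨ ≈m-sym
        (≋⇒≈m (⊗m-assoc (𝕀 𝔸*) φm (𝕀 𝔸))))
      θ-past-φ : ((𝕀 𝔸* ⊗m φm) ⊗m 𝕀 𝔸) ▸ (𝕀 (A * ∷ A ∷ []) ⊗m θ𝔸)
        ≈m (𝕀 (A * ∷ A ∷ A * ∷ []) ⊗m θ𝔸) ▸ ((𝕀 𝔸* ⊗m φm) ⊗m 𝕀 𝔸)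
      θ-past-φ = serialiseˡ ⟫ ≈m-sym serialiseʳ
      φ⊗φ : (𝕀 𝔸 ⊗m (𝕀 𝔸* ⊗m φm)) ▸ (φm ⊗m 𝕀 𝔸) ≈m φm ⊗m φm
      φ⊗φ = (≈m-sym (≋⇒≈m (⊗m-assoc (𝕀 𝔸) (𝕀 𝔸*) φm)) ⟫ 𝕀⊗𝕀 ⟩⊗⟨refl) ⟩▸⟨refl ⟫ serialiseʳ
      hex : σm (A * ∷ A ∷ A * ∷ []) 𝔸 ≈m (𝕀 (A * ∷ A ∷ []) ⊗m σm 𝔸* 𝔸) ▸ (σm (A * ∷ A ∷ []) 𝔸 ⊗m 𝕀 𝔸*)
      hex = ≈m-split (hexagon₂-≋ (A * ∷ A ∷ []) 𝔸* 𝔸 refl)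
      cup′-θ-σ : cup′ ▸ (𝕀 𝔸* ⊗m θ𝔸) ▸ σm 𝔸* 𝔸 ≈m cup
      cup′-θ-σ = ▸-assoc ⟫ refl⟩▸⟨ σm-natural ⟫ ▸-assoc˘ ⟫ cup′-untwist
      double-cup-appears : cup′-cup′ ▸ (𝕀 (A * ∷ A ∷ A * ∷ []) ⊗m θ𝔸) ▸ σm (A * ∷ A ∷ A * ∷ []) 𝔸
        ≈m double-cup
      double-cup-appears = refl⟩▸⟨ hex ⟫ ▸-assoc˘
        ⟫ ((refl⟩▸⟨ (≈m-sym 𝕀⊗𝕀 ⟩⊗⟨refl ⟫ ≋⇒≈m (⊗m-assoc (𝕀 (A * ∷ A ∷ [])) (𝕀 𝔸*) θ𝔸))) ⟩▸⟨refl ⟫ ▸-assoc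
        ⟫ refl⟩▸⟨ ≈m-sym (𝕀⊗-▸ (A * ∷ A ∷ [])) ⟫ ▸-assoc
        ⟫ refl⟩▸⟨ (≈m-sym (𝕀⊗-▸ (A * ∷ A ∷ [])) ⟫ refl⟩⊗⟨ (▸-assoc˘ ⟫ cup′-θ-σ))) ⟩▸⟨refl
        ⟫ (≈m-sym (≋⇒≈m (⊗m-unitʳ cup′)) ⟩▸⟨refl ⟫ serialiseˡ ⟫ ≈m-sym serialiseʳ
        ⟫ ⊗m-unitˡ cup ⟩▸⟨refl) ⟩▸⟨refl ⟫ ▸-assoc
        ⟫ (refl⟩▸⟨ ((refl⟩⊗⟨ ≈m-sym 𝕀⊗𝕀 ⟫ ≈m-sym (≋⇒≈m (⊗m-assoc cup′ (𝕀 𝔸) (𝕀 𝔸*)))) ⟩▸⟨refl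
        ⟫ ≈m-sym (▸-⊗𝕀 𝔸*) ⟫ ≋⇒≈m (σm-absorbs-stateˡ 𝔸 cup′) ⟩⊗⟨refl
        ⟫ ≋⇒≈m (⊗m-assoc (𝕀 𝔸) cup′ (𝕀 𝔸*))))

  un-▸³ : ∀ {u v w x y} (a : Mor u v) (b : Mor v w) (c : Mor w x) (d : Mor x y) → un (a ▸ b ▸ c ▸ d)
    ≋ (un a ⨾ un b ⨾ un c ⨾ un d)
  un-▸³ a b c d = ≋-trans (un-▸ _ _) (⨾-resp-≋ (≋-trans (un-▸ _ _) (⨾-resp-≋ (un-▸ _ _) ≋-refl)) ≋-refl)

  α-planar : αᵐ ≈m double-cup ▸ (φm ⊗m φm)
  α-planar = ≋⇒≈m (≋-trans (trace-yanking α-input α-output _ traced≋)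
    (≋-trans (un-▸³ _ _ _ _)
    (≋-trans (⨾-resp-≋ (⨾-resp-≋ (⨾-resp-≋ input≋ θ-part≋) σ-part≋) output≋)
    (≋-trans (≋-sym (un-▸³ _ _ _ _)) (≈⇒≋ (pf yanked-α-planar))))))
    where
      input≋ : un α-input ≋ un cup′-lam
      input≋ = (coe-elimʳ (sym ⊗-assoc₀) ≋-refl)
      θ-part≋ : un (𝕀 (A * ⊗₀ A ∷ []) ⊗m θ𝔸) ≋ un (𝕀 (A * ∷ A ∷ []) ⊗m θ𝔸)
      θ-part≋ = ≋-trans (un-⊗m _ _)
        (≋-trans (⊗-resp-≋ (≋-trans un-𝕀 (≋-sym un-𝕀)) ≋-refl) (≋-sym (un-⊗m _ _)))
      σ-part≋ : un (σm (A * ⊗₀ A ∷ []) 𝔸) ≋ un (σm (A * ∷ A ∷ []) 𝔸)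
      σ-part≋ = ≋-trans (un-σm _ _) (≋-sym (un-σm _ _))
      output≋ : un α-output ≋ un (φm ⊗m 𝕀 𝔸)
      output≋ = coe-elimˡ (sym ⊗-assoc₀) (≋-sym (≋-trans (un-⊗m φm (𝕀 𝔸)) (⊗-resp-≋ ≋-refl un-𝕀)))
      lift-input : un (𝕀 𝔸 ⊗m cup′-lam) ≋ un (𝕀 𝔸 ⊗m α-input)
      lift-input = ≋-trans (un-⊗m _ _)
        (≋-trans (⊗-resp-≋ ≋-refl (≋-sym (coe-elimʳ (sym ⊗-assoc₀) ≋-refl))) (≋-sym (un-⊗m _ _)))
      lift-output : un (φm ⊗m 𝕀 (A ∷ A ∷ [])) ≋ un (α-output ⊗m 𝕀 𝔸)
      lift-output = ≋-trans (un-⊗m _ _)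
        (≋-trans (⊗-resp-≋ ≋-refl un-𝕀)
        (≋-trans (≋-trans (≈⇒≋ (⊗-resp-≈ ≈.refl (≈.sym ⊗-id))) (≋-sym ⊗-assoc≋))
        (≋-sym (≋-trans (un-⊗m _ _) (⊗-resp-≋ (coe-elimˡ (sym ⊗-assoc₀) ≋-refl) un-𝕀)))))
      traced≋ : (coe unitˡ₀ ⨾ lam ⨾ (id {A} ⊗₁ lam) ⨾ coe (sym ⊗-assoc₀))
        ≋ un ((𝕀 𝔸 ⊗m α-input) ▸ (α-output ⊗m 𝕀 𝔸))
      traced≋ = ≋-trans (coe-elimʳ (sym ⊗-assoc₀)
        (⨾-resp-≋ (coe-elimˡ unitˡ₀ lam≋lamᵐ)
        (≋-sym (≋-trans (un-⊗m (𝕀 𝔸) lamᵐ) (⊗-resp-≋ un-𝕀 (≋-sym lam≋lamᵐ))))))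
        (≋-trans (≋-sym (un-▸ _ _))
        (≋-trans (≈⇒≋ (pf lam-lam-factorises))
        (≋-trans (un-▸ _ _) (≋-trans (⨾-resp-≋ lift-input lift-output) (≋-sym (un-▸ _ _))))))

  cup-app : (𝕀 𝔸 ⊗m cup) ▸ (appᵐ ⊗m 𝕀 𝔸*) ≈m φ⁻m
  cup-app = refl⟩▸⟨ ▸-⊗𝕀 𝔸* ⟫ ▸-assoc˘
    ⟫ (refl⟩▸⟨ (≋⇒≈m (⊗m-assoc φ⁻m (𝕀 𝔸) (𝕀 𝔸*)) ⟫ refl⟩⊗⟨ 𝕀⊗𝕀) ⟫ serialiseʳ ⟫ ≈m-sym serialiseˡ
    ⟫ ≋⇒≈m (⊗m-unitʳ φ⁻m) ⟩▸⟨refl) ⟩▸⟨refl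
    ⟫ ▸-assoc ⟫ refl⟩▸⟨ ((≈m-sym 𝕀⊗𝕀 ⟩⊗⟨refl ⟫ ≋⇒≈m (⊗m-assoc (𝕀 𝔸) (𝕀 𝔸*) cup)) ⟩▸⟨ ≋⇒≈m
    (⊗m-assoc (𝕀 𝔸) cap (𝕀 𝔸*)) ⟫ ≈m-sym (𝕀⊗-▸ 𝔸) ⟫ refl⟩⊗⟨ snake₂m A ⟫ 𝕀⊗𝕀) ⟫ ▸-identityʳ

  β-planar : βᵐ ≈m (φ⁻m ⊗m φ⁻m) ▸ double-cap
  β-planar = ≋⇒≈m (≋-trans
    (coe-elimʳ unitʳ₀ (coe-elimᵐ ⊗-assoc₀
    (coe-elimᵐ (sym ⊗-assoc₀) (coe-elimˡ (sym unitʳ₀) cup-part) traced-part) cap′-part))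
    (≋-trans (≋-sym (≋-trans (un-▸ _ _) (⨾-resp-≋ (un-▸ _ _) ≋-refl))) (≈⇒≋ (pf straighten))))
    where
      app-app : Mor (A ∷ A ∷ A ∷ []) 𝔸
      app-app = (𝕀 𝔸 ⊗m appᵐ) ▸ appᵐ
      traced≋ : (coe ⊗-assoc₀ ⨾ (id {A} ⊗₁ app) ⨾ app ⨾ coe (sym unitˡ₀)) ≋ un app-app
      traced≋ = ≋-trans (coe-elimʳ (sym unitˡ₀)
        (⨾-resp-≋ (coe-elimˡ ⊗-assoc₀ (≋-sym (≋-trans (un-⊗m (𝕀 𝔸) appᵐ) (⊗-resp-≋ un-𝕀 (≋-sym app≋appᵐ)))))
        app≋appᵐ)) (≋-sym (un-▸ _ _))
      cup-part : (id {A ⊗₀ A} ⊗₁ η A) ≋ un (𝕀 (A ∷ A ∷ []) ⊗m cup)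
      cup-part = ≋-sym (≋-trans (un-⊗m _ _) (⊗-resp-≋ un-𝕀 ≋-refl))
      traced-part : ((coe ⊗-assoc₀ ⨾ (id {A} ⊗₁ app) ⨾ app ⨾ coe (sym unitˡ₀)) ⊗₁ id {A *})
        ≋ un (app-app ⊗m 𝕀 𝔸*)
      traced-part = ≋-sym (≋-trans (un-⊗m _ _) (⊗-resp-≋ (≋-sym traced≋) un-𝕀))
      cap′-part : (id {𝟙} ⊗₁ (σ A (A *) ⨾ (id {A *} ⊗₁ θ A) ⨾ ε A)) ≋ un cap′
      cap′-part = ≋-trans ⊗-unitˡ≋ (≋-sym un-cap′)
      straighten : (𝕀 (A ∷ A ∷ []) ⊗m cup) ▸ (app-app ⊗m 𝕀 𝔸*) ▸ cap′ ≈m (φ⁻m ⊗m φ⁻m) ▸ double-cap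
      straighten = (refl⟩▸⟨ ▸-⊗𝕀 𝔸* ⟫ ▸-assoc˘
        ⟫ ((≈m-sym 𝕀⊗𝕀 ⟩⊗⟨refl ⟫ ≋⇒≈m (⊗m-assoc (𝕀 𝔸) (𝕀 𝔸) cup)) ⟩▸⟨ ≋⇒≈m (⊗m-assoc (𝕀 𝔸) appᵐ (𝕀 𝔸*))
        ⟫ ≈m-sym (𝕀⊗-▸ 𝔸) ⟫ refl⟩⊗⟨ cup-app) ⟩▸⟨refl) ⟩▸⟨refl
        ⟫ (refl⟩▸⟨ ▸-⊗𝕀 𝔸* ⟫ ▸-assoc˘
        ⟫ (refl⟩▸⟨ (≋⇒≈m (⊗m-assoc φ⁻m (𝕀 𝔸) (𝕀 𝔸*)) ⟫ refl⟩⊗⟨ 𝕀⊗𝕀) ⟫ serialiseʳ) ⟩▸⟨refl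
        ⟫ refl⟩▸⟨ ≋⇒≈m (⊗m-assoc (𝕀 𝔸) cap (𝕀 𝔸*))) ⟩▸⟨refl ⟫ ▸-assoc

  swapθ-double-cup : double-cup ▸ σm 𝔸𝔸* 𝔸𝔸* ▸ (θm 𝔸𝔸* ⊗m 𝕀 𝔸𝔸*) ≈m double-cup
  swapθ-double-cup = swapθ-nested cup cup′ ⟫ (cup′-untwist ⟩▸⟨ (refl⟩⊗⟨ (cup-twist ⟩⊗⟨refl)))

  double-cup-untwisted : double-cup ≈m double-cup ▸ (θ⁻m 𝔸𝔸* ⊗m 𝕀 𝔸𝔸*) ▸ σ⁻m 𝔸𝔸* 𝔸𝔸*
  double-cup-untwisted = ≈m-sym
    ((≈m-sym swapθ-double-cup ⟩▸⟨refl) ⟩▸⟨refl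
    ⟫ (▸-assoc ⟫ refl⟩▸⟨ (≈m-sym (▸-⊗𝕀 𝔸𝔸*) ⟫ θm-θ⁻m 𝔸𝔸* ⟩⊗⟨refl ⟫ 𝕀⊗𝕀) ⟫ ▸-identityʳ) ⟩▸⟨refl ⟫ ▸-assoc
    ⟫ refl⟩▸⟨ σm-σ⁻m 𝔸𝔸* 𝔸𝔸* ⟫ ▸-identityʳ)

  snake-double : (double-cup ⊗m 𝕀 𝔸𝔸*) ▸ (𝕀 𝔸𝔸* ⊗m double-cap) ≈m 𝕀 𝔸𝔸*
  snake-double = snake-nested cup′ cap′ cup cap snake′ (snake₁m A)

  cup-φ⁻ : Mor [] (A ∷ A * ∷ A * ∷ [])
  cup-φ⁻ = cup ▸ (φ⁻m ⊗m 𝕀 𝔸*)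
  bent-double-cap : Mor 𝔸𝔸* 𝔸*
  bent-double-cap = (𝕀 𝔸𝔸* ⊗m cup-φ⁻) ▸ (double-cap ⊗m 𝕀 𝔸*)

  double-cup-▸-𝕀⊗bent : double-cup ▸ (𝕀 𝔸𝔸* ⊗m bent-double-cap) ≈m cup-φ⁻
  double-cup-▸-𝕀⊗bent = refl⟩▸⟨ 𝕀⊗-▸ 𝔸𝔸* ⟫ ▸-assoc˘
    ⟫ (refl⟩▸⟨ (≈m-sym (≋⇒≈m (⊗m-assoc (𝕀 𝔸𝔸*) (𝕀 𝔸𝔸*) cup-φ⁻)) ⟫ 𝕀⊗𝕀 ⟩⊗⟨refl)
    ⟫ ≈m-sym (≋⇒≈m (⊗m-unitʳ double-cup)) ⟩▸⟨refl ⟫ serialiseˡ ⟫ ≈m-sym serialiseʳ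
    ⟫ ⊗m-unitˡ cup-φ⁻ ⟩▸⟨refl) ⟩▸⟨refl
    ⟫ ▸-assoc ⟫ refl⟩▸⟨ ((refl⟩⊗⟨ ≈m-sym 𝕀⊗𝕀
    ⟫ ≈m-sym (≋⇒≈m (⊗m-assoc double-cup (𝕀 𝔸𝔸*) (𝕀 𝔸*)))) ⟩▸⟨ ≈m-sym
    (≋⇒≈m (⊗m-assoc (𝕀 𝔸𝔸*) double-cap (𝕀 𝔸*))) ⟫ ≈m-sym (▸-⊗𝕀 𝔸*) ⟫ snake-double ⟩⊗⟨refl ⟫ 𝕀⊗𝕀)
    ⟫ ▸-identityʳ

  double-cup-▸-bent⊗𝕀 : double-cup ▸ (bent-double-cap ⊗m 𝕀 𝔸𝔸*) ≈m cup′ ▸ (𝕀 𝔸* ⊗m φ⁻m)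
  double-cup-▸-bent⊗𝕀 = double-cup-untwisted ⟩▸⟨refl ⟫ ▸-assoc ⟫ refl⟩▸⟨ ≈m-sym σ⁻m-natural ⟫ ▸-assoc˘
    ⟫ (▸-assoc ⟫ refl⟩▸⟨ (serialiseˡ ⟫ ≈m-sym serialiseʳ) ⟫ ▸-assoc˘ ⟫ double-cup-▸-𝕀⊗bent ⟩▸⟨refl) ⟩▸⟨refl
    ⟫ (▸-assoc ⟫ refl⟩▸⟨ (≈m-sym (▸-⊗𝕀 𝔸*) ⟫ θ⁻m-natural ⟩⊗⟨refl ⟫ ▸-⊗𝕀 𝔸*) ⟫ ▸-assoc˘) ⟩▸⟨refl ⟫ ▸-assoc
    ⟫ refl⟩▸⟨ σ⁻m-natural ⟫ ▸-assoc˘ ⟫ ((θ⁻-slides-along-cup ⟩▸⟨refl) ⟩▸⟨refl)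

  κ-middle : (φm ⊗m φm) ▸ (𝕀 𝔸 ⊗m (cup ⊗m 𝕀 𝔸)) ▸ (((φ⁻m ⊗m φ⁻m) ▸ double-cap) ⊗m 𝕀 (A * ∷ A ∷ []))
    ≈m (bent-double-cap ⊗m 𝕀 𝔸𝔸*) ▸ (𝕀 𝔸* ⊗m φm)
  κ-middle = refl⟩▸⟨ ▸-⊗𝕀 (A * ∷ A ∷ []) ⟫ ▸-assoc˘ ⟫ split ⟩▸⟨refl ⟫ regroup
    where
      φ-cup-φ⁻φ⁻ : (φm ▸ (𝕀 𝔸 ⊗m cup)) ▸ ((φ⁻m ⊗m φ⁻m) ⊗m 𝕀 𝔸*) ≈m 𝕀 𝔸𝔸* ⊗m cup-φ⁻
      φ-cup-φ⁻φ⁻ = (≈m-sym (≋⇒≈m (⊗m-unitʳ φm)) ⟩▸⟨refl ⟫ serialiseˡ ⟫ ≈m-sym serialiseʳ) ⟩▸⟨refl ⟫ ▸-assoc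
        ⟫ refl⟩▸⟨ ((refl⟩⊗⟨ ≈m-sym 𝕀⊗𝕀 ⟫ ≈m-sym (≋⇒≈m (⊗m-assoc φm (𝕀 𝔸) (𝕀 𝔸*)))) ⟩▸⟨refl
        ⟫ ≈m-sym (▸-⊗𝕀 𝔸*) ⟫ (≈m-sym interchange ⟫ φm-φ⁻m ⟩⊗⟨ ▸-identityˡ) ⟩⊗⟨refl
        ⟫ ≋⇒≈m (⊗m-assoc (𝕀 𝔸𝔸*) φ⁻m (𝕀 𝔸*)))
        ⟫ ≈m-sym (𝕀⊗-▸ 𝔸𝔸*)
      split : (φm ⊗m φm) ▸ (𝕀 𝔸 ⊗m (cup ⊗m 𝕀 𝔸)) ▸ ((φ⁻m ⊗m φ⁻m) ⊗m 𝕀 (A * ∷ A ∷ []))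
        ≈m (𝕀 𝔸𝔸* ⊗m cup-φ⁻) ⊗m φm
      split = (refl⟩▸⟨ ≈m-sym (≋⇒≈m (⊗m-assoc (𝕀 𝔸) cup (𝕀 𝔸)))) ⟩▸⟨ (refl⟩⊗⟨ ≈m-sym 𝕀⊗𝕀
        ⟫ ≈m-sym (≋⇒≈m (⊗m-assoc (φ⁻m ⊗m φ⁻m) (𝕀 𝔸*) (𝕀 𝔸))))
        ⟫ ≈m-sym interchange ⟩▸⟨refl ⟫ ≈m-sym interchange ⟫ (φ-cup-φ⁻φ⁻ ⟩⊗⟨ (▸-identityʳ ⟫ ▸-identityʳ))
      regroup : ((𝕀 𝔸𝔸* ⊗m cup-φ⁻) ⊗m φm) ▸ (double-cap ⊗m 𝕀 (A * ∷ A ∷ []))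
        ≈m (bent-double-cap ⊗m 𝕀 𝔸𝔸*) ▸ (𝕀 𝔸* ⊗m φm)
      regroup = ≈m-sym serialiseˡ ⟩▸⟨refl ⟫ ▸-assoc
        ⟫ refl⟩▸⟨ (refl⟩▸⟨ (refl⟩⊗⟨ ≈m-sym 𝕀⊗𝕀 ⟫ ≈m-sym (≋⇒≈m (⊗m-assoc double-cap (𝕀 𝔸*) (𝕀 𝔸))))
        ⟫ serialiseʳ ⟫ ≈m-sym serialiseˡ) ⟫ ▸-assoc˘ ⟫ (≈m-sym (▸-⊗𝕀 𝔸𝔸*) ⟩▸⟨refl)

  κ : Mor [] (A * ∷ A ∷ [])
  κ = αᵐ ▸ (𝕀 𝔸 ⊗m (cup ⊗m 𝕀 𝔸)) ▸ (βᵐ ⊗m 𝕀 (A * ∷ A ∷ []))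

  κ≈cup′ : κ ≈m cup′
  κ≈cup′ = begin
      κ
    ≈⟨ (α-planar ⟩▸⟨refl) ⟩▸⟨ (β-planar ⟩⊗⟨refl) ⟩
      double-cup ▸ (φm ⊗m φm) ▸ (𝕀 𝔸 ⊗m (cup ⊗m 𝕀 𝔸)) ▸ (((φ⁻m ⊗m φ⁻m) ▸ double-cap) ⊗m 𝕀 𝔸*𝔸)
    ≈⟨ ▸-assoc ⟩▸⟨refl ⟫ ▸-assoc ⟫ refl⟩▸⟨ κ-middle ⟫ ▸-assoc˘ ⟩
      double-cup ▸ (bent-double-cap ⊗m 𝕀 𝔸𝔸*) ▸ (𝕀 𝔸* ⊗m φm)
    ≈⟨ double-cup-▸-bent⊗𝕀 ⟩▸⟨refl ⟩
      cup′ ▸ (𝕀 𝔸* ⊗m φ⁻m) ▸ (𝕀 𝔸* ⊗m φm)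
    ≈⟨ ▸-assoc ⟫ refl⟩▸⟨ (≈m-sym (𝕀⊗-▸ 𝔸*) ⟫ refl⟩⊗⟨ φ⁻m-φm ⟫ 𝕀⊗𝕀) ⟫ ▸-identityʳ ⟩
      cup′
    ∎

  elt : Hom 𝟙 A → Mor [] 𝔸
  elt x = ⌜ x ⌝

  infixl 8 _·ᵐ_
  _·ᵐ_ : ∀ {u v} → Mor u 𝔸 → Mor v 𝔸 → Mor (u ++ v) 𝔸
  x ·ᵐ y = (x ⊗m y) ▸ appᵐ

  applied : Mor [] 𝔸 → Mor 𝔸 𝔸
  applied x = x ·ᵐ 𝕀 𝔸

  app₂ᵐ : Mor (A ∷ A ∷ A ∷ []) 𝔸
  app₂ᵐ = (appᵐ ⊗m 𝕀 𝔸) ▸ appᵐ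
  app₃ᵐ : Mor (A ∷ A ∷ A ∷ A ∷ []) 𝔸
  app₃ᵐ = (appᵐ ⊗m 𝕀 (A ∷ A ∷ [])) ▸ app₂ᵐ

  elt-· : ∀ x y → elt (x · y) ≈m elt x ·ᵐ elt y
  elt-· x y = ≋⇒≈m (≋-trans (⨾-resp-≋ (coe-elimˡ (sym unitˡ₀) (≋-sym (un-⊗m (elt x) (elt y)))) app≋appᵐ)
    (≋-sym (un-▸ _ _)))

  app₂≋app₂ᵐ : appₙ 2 ≋ un app₂ᵐ
  app₂≋app₂ᵐ = ≋-trans (appₙ-suc 0)
    (≋-trans (un-▸ _ _) (≋-trans
    (⨾-resp-≋ (≋-trans (un-⊗m appᵐ (𝕀 _))
    (≋-trans (⊗-resp-≋ ≋-refl (𝕀≋𝕀 unitʳ₀)) (≋-sym (un-⊗m appᵐ (𝕀 𝔸))))) appₙ-one) (≋-sym (un-▸ _ _))))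
  app₃≋app₃ᵐ : appₙ 3 ≋ un app₃ᵐ
  app₃≋app₃ᵐ = ≋-trans (appₙ-suc 1)
    (≋-trans (un-▸ _ _) (≋-trans
    (⨾-resp-≋ (≋-trans (un-⊗m appᵐ (𝕀 _))
    (≋-trans (⊗-resp-≋ ≋-refl (𝕀≋𝕀 p2)) (≋-sym (un-⊗m appᵐ (𝕀 (A ∷ A ∷ [])))))) app₂≋app₂ᵐ)
    (≋-sym (un-▸ _ _))))

  app-app≈app₂ : ∀ {u} (s : Mor u (A ∷ A ∷ [])) → ((s ▸ appᵐ) ⊗m 𝕀 𝔸) ▸ appᵐ ≈m (s ⊗m 𝕀 𝔸) ▸ app₂ᵐ
  app-app≈app₂ s = ▸-⊗𝕀 𝔸 ⟩▸⟨refl ⟫ ▸-assoc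
  app₂-app≈app₃ : ∀ {u} (s : Mor u (A ∷ A ∷ A ∷ [])) → ((s ▸ app₂ᵐ) ⊗m 𝕀 𝔸) ▸ appᵐ ≈m (s ⊗m 𝕀 𝔸) ▸ app₃ᵐ
  app₂-app≈app₃ s = ▸-⊗𝕀 𝔸 ⟩▸⟨refl ⟫ ▸-assoc
    ⟫ (refl⟩▸⟨ (▸-⊗𝕀 𝔸 ⟩▸⟨refl ⟫ ▸-assoc ⟫ (≋⇒≈m (⊗m-assoc appᵐ (𝕀 𝔸) (𝕀 𝔸)) ⟫ refl⟩⊗⟨ 𝕀⊗𝕀) ⟩▸⟨refl))

  𝐓𝐫-β : (elt 𝐓𝐫 ⊗m 𝕀 (A ∷ A ∷ [])) ▸ app₂ᵐ ≈m (𝕀 𝔸 ⊗m lamᵐ) ▸ app₂ᵐ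
  𝐓𝐫-β = ≋⇒≈m (≋-trans (un-▸ _ _)
    (≋-trans (⨾-resp-≋ constant≋ (≋-sym app₂≋app₂ᵐ))
    (≋-trans (F-β {1} {2} (coe p1 ⨾ lam ⨾ coe (sym p2)))
    (≋-trans (⨾-resp-≋ combinator≋ app₂≋app₂ᵐ) (≋-sym (un-▸ _ _))))))
    where
      constant≋ : un (elt 𝐓𝐫 ⊗m 𝕀 (A ∷ A ∷ [])) ≋ (𝐓𝐫 ⊗₁ id {A^ 2})
      constant≋ = ≋-trans (un-⊗m (elt 𝐓𝐫) (𝕀 (A ∷ A ∷ []))) (⊗-resp-≋ ≋-refl (≋-trans un-𝕀 (id≋id (sym p2))))
      combinator≋ : (id {A} ⊗₁ (coe p1 ⨾ lam ⨾ coe (sym p2))) ≋ un (𝕀 𝔸 ⊗m lamᵐ)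
      combinator≋ = ≋-trans (⊗-resp-≋ ≋-refl (coe-elimʳ (sym p2) (coe-elimˡ p1 lam≋lamᵐ)))
        (≋-sym (≋-trans (un-⊗m (𝕀 𝔸) lamᵐ) (⊗-resp-≋ un-𝕀 ≋-refl)))

  𝐁-β : (elt 𝐁 ⊗m 𝕀 (A ∷ A ∷ A ∷ [])) ▸ app₃ᵐ ≈m (𝕀 𝔸 ⊗m appᵐ) ▸ appᵐ
  𝐁-β = ≋⇒≈m (≋-trans (un-▸ _ _)
    (≋-trans (⨾-resp-≋ constant≋ (≋-sym app₃≋app₃ᵐ))
    (≋-trans (F-β {2} {1} (coe p2 ⨾ app ⨾ coe (sym p1)))
    (≋-trans (⨾-resp-≋ combinator≋ appₙ-one) (≋-sym (un-▸ _ _))))))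
    where
      constant≋ : un (elt 𝐁 ⊗m 𝕀 (A ∷ A ∷ A ∷ [])) ≋ (𝐁 ⊗₁ id {A^ 3})
      constant≋ = ≋-trans (un-⊗m (elt 𝐁) (𝕀 (A ∷ A ∷ A ∷ [])))
        (⊗-resp-≋ ≋-refl (≋-trans un-𝕀 (id≋id (cong (A ⊗₀_) (sym p2)))))
      combinator≋ : (id {A} ⊗₁ (coe p2 ⨾ app ⨾ coe (sym p1))) ≋ un (𝕀 𝔸 ⊗m appᵐ)
      combinator≋ = ≋-trans (⊗-resp-≋ ≋-refl (coe-elimʳ (sym p1) (coe-elimˡ p2 app≋appᵐ)))
        (≋-sym (≋-trans (un-⊗m (𝕀 𝔸) appᵐ) (⊗-resp-≋ un-𝕀 ≋-refl)))

  𝛂-β : (elt 𝛂 ⊗m 𝕀 𝔸) ▸ appᵐ ≈m (𝕀 𝔸 ⊗m αᵐ) ▸ app₂ᵐ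
  𝛂-β = ≋⇒≈m (≋-trans (un-▸ _ _)
    (≋-trans (⨾-resp-≋ constant≋ (≋-sym appₙ-one))
    (≋-trans (F-β {0} {2} (α ⨾ coe (sym p2)))
    (≋-trans (⨾-resp-≋ combinator≋ app₂≋app₂ᵐ) (≋-sym (un-▸ _ _))))))
    where
      constant≋ : un (elt 𝛂 ⊗m 𝕀 𝔸) ≋ (𝛂 ⊗₁ id {A^ 1})
      constant≋ = ≋-trans (un-⊗m (elt 𝛂) (𝕀 𝔸)) (⊗-resp-≋ ≋-refl (≋-trans un-𝕀 (id≋id (sym unitʳ₀))))
      combinator≋ : (id {A} ⊗₁ (α ⨾ coe (sym p2))) ≋ un (𝕀 𝔸 ⊗m αᵐ)
      combinator≋ = ≋-trans (⊗-resp-≋ ≋-refl (coe-elimʳ (sym p2) ≋-refl))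
        (≋-sym (≋-trans (un-⊗m (𝕀 𝔸) αᵐ) (⊗-resp-≋ un-𝕀 ≋-refl)))

  𝛃-β : (elt 𝛃 ⊗m 𝕀 (A ∷ A ∷ A ∷ [])) ▸ app₃ᵐ ≈m 𝕀 𝔸 ⊗m βᵐ
  𝛃-β = ≋⇒≈m (≋-trans (un-▸ _ _)
    (≋-trans (⨾-resp-≋ constant≋ (≋-sym app₃≋app₃ᵐ)) (≋-trans (F-β {2} {0} (coe p2 ⨾ β)) combinator≋)))
    where
      constant≋ : un (elt 𝛃 ⊗m 𝕀 (A ∷ A ∷ A ∷ [])) ≋ (𝛃 ⊗₁ id {A^ 3})
      constant≋ = ≋-trans (un-⊗m (elt 𝛃) (𝕀 (A ∷ A ∷ A ∷ [])))
        (⊗-resp-≋ ≋-refl (≋-trans un-𝕀 (id≋id (cong (A ⊗₀_) (sym p2)))))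
      combinator≋ : ((id {A} ⊗₁ (coe p2 ⨾ β)) ⨾ appₙ 0) ≋ un (𝕀 𝔸 ⊗m βᵐ)
      combinator≋ = ≋-trans (coe-elimʳ unitʳ₀ (⊗-resp-≋ ≋-refl (coe-elimˡ p2 ≋-refl)))
        (≋-sym (≋-trans (un-⊗m (𝕀 𝔸) βᵐ) (⊗-resp-≋ un-𝕀 ≋-refl)))

  𝐁ᵐ : Mor [] 𝔸
  𝐁ᵐ = elt 𝐁

  elt-∘ : ∀ x y → elt (x ∘ y) ≈m 𝐁ᵐ ·ᵐ elt x ·ᵐ elt y
  elt-∘ x y = elt-· (𝐁 · x) y ⟫ (elt-· 𝐁 x ⟩⊗⟨refl) ⟩▸⟨refl

  applied-resp : ∀ {x y : Mor [] 𝔸} → x ≈m y → applied x ≈m applied y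
  applied-resp p = (p ⟩⊗⟨refl) ⟩▸⟨refl

  elt-from-applied : ∀ (x : Mor [] 𝔸) → x ≈m cup ▸ (applied x ⊗m 𝕀 𝔸*) ▸ φm
  elt-from-applied x = ≈m-sym ((refl⟩▸⟨ ▸-⊗𝕀 𝔸* ⟫ ▸-assoc˘
    ⟫ (refl⟩▸⟨ (≋⇒≈m (⊗m-assoc x (𝕀 𝔸) (𝕀 𝔸*)) ⟫ refl⟩⊗⟨ 𝕀⊗𝕀) ⟫ ≈m-sym x-commutes) ⟩▸⟨refl
    ⟫ ▸-assoc ⟫ refl⟩▸⟨ cup-app) ⟩▸⟨refl ⟫ ▸-assoc ⟫ refl⟩▸⟨ φ⁻m-φm ⟫ ▸-identityʳ)
    where
      x-commutes : x ▸ (𝕀 𝔸 ⊗m cup) ≈m cup ▸ (x ⊗m 𝕀 𝔸𝔸*)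
      x-commutes = ≈m-sym (≋⇒≈m (⊗m-unitʳ x)) ⟩▸⟨refl ⟫ serialiseˡ ⟫ ≈m-sym serialiseʳ ⟫ ⊗m-unitˡ cup ⟩▸⟨refl

  applied-injective : ∀ {x y : Mor [] 𝔸} → applied x ≈m applied y → x ≈m y
  applied-injective {x} {y} p =
    elt-from-applied x ⟫ (refl⟩▸⟨ (p ⟩⊗⟨refl)) ⟩▸⟨refl ⟫ ≈m-sym (elt-from-applied y)

  binary-from-applied : ∀ (u : Mor (A ∷ A ∷ []) 𝔸) →
                        u ≈m (𝕀 (A ∷ A ∷ []) ⊗m cup) ▸ ((u ·ᵐ 𝕀 𝔸) ⊗m 𝕀 𝔸*) ▸ φm
  binary-from-applied u = ≈m-sym ((refl⟩▸⟨ ▸-⊗𝕀 𝔸* ⟫ ▸-assoc˘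
    ⟫ (refl⟩▸⟨ (≋⇒≈m (⊗m-assoc u (𝕀 𝔸) (𝕀 𝔸*)) ⟫ refl⟩⊗⟨ 𝕀⊗𝕀) ⟫ u-commutes) ⟩▸⟨refl
    ⟫ ▸-assoc ⟫ refl⟩▸⟨ cup-app) ⟩▸⟨refl ⟫ ▸-assoc ⟫ refl⟩▸⟨ φ⁻m-φm ⟫ ▸-identityʳ)
    where
      u-commutes : (𝕀 (A ∷ A ∷ []) ⊗m cup) ▸ (u ⊗m 𝕀 𝔸𝔸*) ≈m u ▸ (𝕀 𝔸 ⊗m cup)
      u-commutes = serialiseʳ ⟫ ≈m-sym serialiseˡ ⟫ ≋⇒≈m (⊗m-unitʳ u) ⟩▸⟨refl

  applied-∘ : ∀ (x y : Mor [] 𝔸) → applied (𝐁ᵐ ·ᵐ x ·ᵐ y) ≈m applied y ▸ applied x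
  applied-∘ x y = app-app≈app₂ _
    ⟫ (≋⇒≈m (⊗m-assoc (𝐁ᵐ ·ᵐ x) y (𝕀 𝔸)) ⟫ refl⟩⊗⟨ ≈m-sym ▸-identityʳ ⟫ interchange) ⟩▸⟨refl ⟫ ▸-assoc
    ⟫ (≋⇒≈m (⊗m-assoc 𝐁ᵐ x (y ⊗m 𝕀 𝔸)) ⟫ ≈m-sym serialiseʳ ⟫ ⊗m-unitˡ _ ⟩▸⟨refl) ⟩▸⟨refl
    ⟫ ▸-assoc ⟫ refl⟩▸⟨ 𝐁-β ⟫ ▸-assoc˘
    ⟫ (≈m-sym interchange ⟫ ▸-identityʳ ⟩⊗⟨refl) ⟩▸⟨refl
    ⟫ (≈m-sym serialiseʳ ⟫ ⊗m-unitˡ _ ⟩▸⟨refl) ⟩▸⟨refl ⟫ ▸-assoc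

  applied-𝐁· : ∀ (x : Mor [] 𝔸) → applied (𝐁ᵐ ·ᵐ x) ·ᵐ 𝕀 𝔸 ≈m appᵐ ▸ applied x
  applied-𝐁· x = (app-app≈app₂ _ ⟩⊗⟨refl) ⟩▸⟨refl ⟫ app₂-app≈app₃ _
    ⟫ (≋⇒≈m (⊗m-assoc (𝐁ᵐ ⊗m x) (𝕀 𝔸) (𝕀 𝔸)) ⟫ refl⟩⊗⟨ 𝕀⊗𝕀 ⟫ ≋⇒≈m (⊗m-assoc 𝐁ᵐ x (𝕀 (A ∷ A ∷ [])))
    ⟫ ≈m-sym serialiseʳ ⟫ ⊗m-unitˡ _ ⟩▸⟨refl) ⟩▸⟨refl
    ⟫ ▸-assoc ⟫ refl⟩▸⟨ 𝐁-β ⟫ ▸-assoc˘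
    ⟫ (serialiseˡ ⟫ ≈m-sym serialiseʳ ⟫ ⊗m-unitˡ appᵐ ⟩▸⟨refl) ⟩▸⟨refl ⟫ ▸-assoc

  αᵐ-commutes : ∀ (f : Mor 𝔸 𝔸) → f ▸ (𝕀 𝔸 ⊗m αᵐ) ≈m (𝕀 𝔸 ⊗m αᵐ) ▸ (f ⊗m 𝕀 (A ∷ A ∷ []))
  αᵐ-commutes f = ≈m-sym (≋⇒≈m (⊗m-unitʳ f)) ⟩▸⟨refl ⟫ serialiseˡ ⟫ ≈m-sym serialiseʳ

  κ-appears : (𝕀 𝔸 ⊗m αᵐ) ▸ (((𝕀 (A ∷ A ∷ []) ⊗m cup) ▸ ((𝕀 𝔸 ⊗m βᵐ) ⊗m 𝕀 𝔸*) ▸ φm) ⊗m 𝕀 𝔸)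
                ≈m (𝕀 𝔸 ⊗m κ) ▸ (φm ⊗m 𝕀 𝔸)
  κ-appears = refl⟩▸⟨ (▸-⊗𝕀 𝔸 ⟫ ▸-⊗𝕀 𝔸 ⟩▸⟨refl) ⟫ ▸-assoc˘
    ⟫ (▸-assoc˘ ⟫ (refl⟩▸⟨ cup-part ⟫ ≈m-sym (𝕀⊗-▸ 𝔸)) ⟩▸⟨ βᵐ-part ⟫ ≈m-sym (𝕀⊗-▸ 𝔸)) ⟩▸⟨refl
    where
      cup-part : (𝕀 (A ∷ A ∷ []) ⊗m cup) ⊗m 𝕀 𝔸 ≈m 𝕀 𝔸 ⊗m (𝕀 𝔸 ⊗m (cup ⊗m 𝕀 𝔸))
      cup-part = ≋⇒≈m (⊗m-assoc (𝕀 (A ∷ A ∷ [])) cup (𝕀 𝔸)) ⟫ ≈m-sym 𝕀⊗𝕀 ⟩⊗⟨refl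
        ⟫ ≋⇒≈m (⊗m-assoc (𝕀 𝔸) (𝕀 𝔸) (cup ⊗m 𝕀 𝔸))
      βᵐ-part : ((𝕀 𝔸 ⊗m βᵐ) ⊗m 𝕀 𝔸*) ⊗m 𝕀 𝔸 ≈m 𝕀 𝔸 ⊗m (βᵐ ⊗m 𝕀 𝔸*𝔸)
      βᵐ-part = ≋⇒≈m (⊗m-assoc (𝕀 𝔸 ⊗m βᵐ) (𝕀 𝔸*) (𝕀 𝔸))
        ⟫ ≋⇒≈m (⊗m-assoc (𝕀 𝔸) βᵐ (𝕀 𝔸* ⊗m 𝕀 𝔸)) ⟫ refl⟩⊗⟨ refl⟩⊗⟨ 𝕀⊗𝕀

  -- The cup hidden in α and β straightens to the twisted cup of lam (κ≈cup′).
  𝛃-𝛂-lam : applied (elt 𝛃) ▸ (𝕀 𝔸 ⊗m αᵐ) ▸ (appᵐ ⊗m 𝕀 𝔸) ≈m lamᵐ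
  𝛃-𝛂-lam = αᵐ-commutes (applied (elt 𝛃)) ⟩▸⟨refl ⟫ ▸-assoc
    ⟫ refl⟩▸⟨ ((refl⟩⊗⟨ ≈m-sym 𝕀⊗𝕀 ⟫ ≈m-sym (≋⇒≈m (⊗m-assoc (applied (elt 𝛃)) (𝕀 𝔸) (𝕀 𝔸)))) ⟩▸⟨refl
    ⟫ ≈m-sym (▸-⊗𝕀 𝔸))
    ⟫ refl⟩▸⟨ ((binary-from-applied u ⟫ (refl⟩▸⟨ (applied-u ⟩⊗⟨refl)) ⟩▸⟨refl) ⟩⊗⟨refl)
    ⟫ κ-appears ⟫ (refl⟩⊗⟨ κ≈cup′) ⟩▸⟨refl
    where
      u = applied (elt 𝛃) ·ᵐ 𝕀 𝔸
      applied-u : u ·ᵐ 𝕀 𝔸 ≈m 𝕀 𝔸 ⊗m βᵐ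
      applied-u = (app-app≈app₂ _ ⟩⊗⟨refl) ⟩▸⟨refl ⟫ app₂-app≈app₃ _
        ⟫ (≋⇒≈m (⊗m-assoc (elt 𝛃 ⊗m 𝕀 𝔸) (𝕀 𝔸) (𝕀 𝔸)) ⟫ refl⟩⊗⟨ 𝕀⊗𝕀
        ⟫ ≋⇒≈m (⊗m-assoc (elt 𝛃) (𝕀 𝔸) (𝕀 (A ∷ A ∷ []))) ⟫ refl⟩⊗⟨ 𝕀⊗𝕀) ⟩▸⟨refl ⟫ 𝛃-β

  applied₂ : Mor [] 𝔸 → Mor (A ∷ A ∷ []) 𝔸
  applied₂ x = (x ⊗m 𝕀 (A ∷ A ∷ [])) ▸ app₂ᵐ

  applied-𝐓𝐫· : ∀ a → applied (elt (𝐓𝐫 · a)) ≈m lamᵐ ▸ applied₂ (elt a)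
  applied-𝐓𝐫· a = begin
      applied (elt (𝐓𝐫 · a))
    ≈⟨ applied-resp (elt-· 𝐓𝐫 a) ⟫ app-app≈app₂ _ ⟩
      ((elt 𝐓𝐫 ⊗m elt a) ⊗m 𝕀 𝔸) ▸ app₂ᵐ
    ≈⟨ (≋⇒≈m (⊗m-assoc (elt 𝐓𝐫) (elt a) (𝕀 𝔸)) ⟫ ≈m-sym serialiseʳ ⟫ ⊗m-unitˡ _ ⟩▸⟨refl) ⟩▸⟨refl
       ⟫ ▸-assoc ⟫ refl⟩▸⟨ 𝐓𝐫-β ⟫ ▸-assoc˘ ⟩
      (elt a ⊗m 𝕀 𝔸) ▸ (𝕀 𝔸 ⊗m lamᵐ) ▸ app₂ᵐ
    ≈⟨ (serialiseˡ ⟫ ≈m-sym serialiseʳ ⟫ ⊗m-unitˡ lamᵐ ⟩▸⟨refl) ⟩▸⟨refl ⟫ ▸-assoc ⟩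
      lamᵐ ▸ applied₂ (elt a)
    ∎

  applied-𝛂∘𝐁·∘𝛃 : ∀ a → applied (elt (𝛂 ∘ ((𝐁 · a) ∘ 𝛃))) ≈m lamᵐ ▸ applied₂ (elt a)
  applied-𝛂∘𝐁·∘𝛃 a = begin
      applied (elt (𝛂 ∘ ((𝐁 · a) ∘ 𝛃)))
    ≈⟨ applied-resp (elt-∘ 𝛂 _) ⟫ applied-∘ (elt 𝛂) _ ⟩
      applied (elt ((𝐁 · a) ∘ 𝛃)) ▸ applied (elt 𝛂)
    ≈⟨ (applied-resp (elt-∘ (𝐁 · a) 𝛃 ⟫ (((refl⟩⊗⟨ elt-· 𝐁 a) ⟩▸⟨refl) ⟩⊗⟨refl) ⟩▸⟨refl)
        ⟫ applied-∘ (𝐁ᵐ ·ᵐ elt a) (elt 𝛃)) ⟩▸⟨ 𝛂-β ⟩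
      applied (elt 𝛃) ▸ applied (𝐁ᵐ ·ᵐ elt a) ▸ ((𝕀 𝔸 ⊗m αᵐ) ▸ app₂ᵐ)
    ≈⟨ ▸-assoc ⟫ refl⟩▸⟨ slide-αᵐ ⟫ ▸-assoc˘ ⟫ ▸-assoc˘ ⟩
      applied (elt 𝛃) ▸ (𝕀 𝔸 ⊗m αᵐ) ▸ (appᵐ ⊗m 𝕀 𝔸) ▸ applied₂ (elt a)
    ≈⟨ 𝛃-𝛂-lam ⟩▸⟨refl ⟩
      lamᵐ ▸ applied₂ (elt a)
    ∎
    where
      slide-αᵐ : applied (𝐁ᵐ ·ᵐ elt a) ▸ ((𝕀 𝔸 ⊗m αᵐ) ▸ app₂ᵐ)
                   ≈m (𝕀 𝔸 ⊗m αᵐ) ▸ ((appᵐ ⊗m 𝕀 𝔸) ▸ applied₂ (elt a))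
      slide-αᵐ = ▸-assoc˘ ⟫ αᵐ-commutes _ ⟩▸⟨refl ⟫ ▸-assoc
        ⟫ refl⟩▸⟨ (▸-assoc˘
        ⟫ ((refl⟩⊗⟨ ≈m-sym 𝕀⊗𝕀 ⟫ ≈m-sym (≋⇒≈m (⊗m-assoc (applied (𝐁ᵐ ·ᵐ elt a)) (𝕀 𝔸) (𝕀 𝔸))))
        ⟩▸⟨refl ⟫ ≈m-sym (▸-⊗𝕀 𝔸)) ⟩▸⟨refl
        ⟫ (applied-𝐁· (elt a) ⟩⊗⟨refl) ⟩▸⟨refl ⟫ ▸-⊗𝕀 𝔸 ⟩▸⟨refl ⟫ ▸-assoc
        ⟫ refl⟩▸⟨ (app-app≈app₂ _ ⟫ (≋⇒≈m (⊗m-assoc (elt a) (𝕀 𝔸) (𝕀 𝔸)) ⟫ refl⟩⊗⟨ 𝕀⊗𝕀) ⟩▸⟨refl))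

  𝐓𝐫-is-trace : ∀ a → 𝐓𝐫 · a ≈ 𝛂 ∘ ((𝐁 · a) ∘ 𝛃)
  𝐓𝐫-is-trace a = pf (applied-injective (applied-𝐓𝐫· a ⟫ ≈m-sym (applied-𝛂∘𝐁·∘𝛃 a)))

proposition4p8 : ∀ {o ℓ e} {C : Category o ℓ e} {M : StrictMonoidal C}
                   {R : Ribbon M} (Rf : Reflexive R) →
                 let open Category C
                     open Combinators Rf
                 in ∀ (m n : ℕ) (a : 𝒜) → HasArity (suc m) (suc n) a →
                    𝐓𝐫 · a ≈ 𝛂 ∘ ((𝐁 · a) ∘ 𝛃)
proposition4p8 Rf _ _ a _ = ReflexiveCalculus.𝐓𝐫-is-trace Rf a
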